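{- Let $D$ be a finite acyclic digraph with nonempty vertex set $V$ and complement $\overline{D}$. For $v\in V$ let $d(v)$ be the number of arrows of $\overline{D}$ pointing from $v$. Then the number of directed spanning trees on $\overline{D}$ is \[ \frac{1}{|V|}\prod_{v\in V}d(v). \]
   Context: A digraph has a finite vertex set $V$ and arrow set a subset of $V\times V$ (loops allowed, no multiple arrows). The complement $\overline{D}$ contains an arrow $e\in V\times V$ (loops included) iff $D$ does not. $D$ is acyclic if it contains no directed cycle (in particular no loop). An arrow $(v,w)$ points from $v$ to $w$. A directed tree with root $r$ is a digraph such that there is a unique directed path from every vertex to $r$. A directed spanning tree on $\overline{D}$ is a spanning subdigraph of $\overline{D}$ (same vertex set $V$) that is a directed tree (with any root). -}

module Defs where

open import Data.Nat using (ℕ; zero; suc; _+_)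
open import Data.Bool using (Bool; true; false; if_then_else_)
open import Data.Fin using (Fin)
open import Data.Vec using (Vec; lookup)
open import Data.List using (List; map; allFin)
open import Data.Nat.ListAction using (sum; product)
open import Data.Product using (Σ; _×_)
open import Data.Empty using (⊥)
open import Relation.Binary.PropositionalEquality using (_≡_)

-- A digraph on vertex set Fin n, given by its (Boolean) adjacency matrix.
-- Loops allowed, no multiple arrows.  Row u, column v = true  iff  (u,v) is an arrow.
Digraph : ℕ → Set
Digraph n = Vec (Vec Bool n) n

Arrow : ∀ {n} → Digraph n → Fin n → Fin n → Set
Arrow D u v = lookup (lookup D u) v ≡ true

data Walk {n : ℕ} (D : Digraph n) : Fin n → Fin n → Set where
  nil  : ∀ {v} → Walk D v v
  cons : ∀ {u w v} → Arrow D u w → Walk D w v → Walk D u v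

-- D contains no directed cycle (in particular no loop):
-- there is no arrow u → w followed by a walk w → u.
Acyclic : ∀ {n} → Digraph n → Set
Acyclic D = ∀ u w → Arrow D u w → Walk D w u → ⊥

IsDirectedTreeWithRoot : ∀ {n} → Digraph n → Fin n → Set
IsDirectedTreeWithRoot T r = ∀ v → Σ (Walk T v r) (λ p → ∀ q → q ≡ p)

IsDirectedTree : ∀ {n} → Digraph n → Set
IsDirectedTree {n} T = Σ (Fin n) (IsDirectedTreeWithRoot T)

SubOfComplement : ∀ {n} → Digraph n → Digraph n → Set
SubOfComplement T D = ∀ u v → Arrow T u v → Arrow D u v → ⊥

-- Directed spanning tree on the complement of D (vertex set is all of Fin n).
IsDirectedSpanningTreeOnComplement : ∀ {n} → Digraph n → Digraph n → Set
IsDirectedSpanningTreeOnComplement D T = SubOfComplement T D × IsDirectedTree T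

-- d(v): number of arrows of the complement of D pointing from v,
-- i.e. the number of w (w = v included) with (v,w) not an arrow of D.
complOutDeg : ∀ {n} → Digraph n → Fin n → ℕ
complOutDeg {n} D v =
  sum (map (λ w → if lookup (lookup D v) w then 0 else 1) (allFin n))

prodComplOutDeg : ∀ {n} → Digraph n → ℕ
prodComplOutDeg {n} D = product (map (complOutDeg D) (allFin n))

module Submission where

open import Defs
open import Data.Nat using (ℕ; suc; _*_; _≤_; _<_)
open import Data.Fin using (Fin)
open import Data.List using (List; length)
open import Data.List.Membership.Propositional using (_∈_)
open import Data.List.Relation.Unary.Unique.Propositional using (Unique)
open import Data.Product using (Σ; _×_; _,_)
open import Function.Bundles using (_⇔_)
open import Relation.Binary.PropositionalEquality using (_≡_)

-- Let D be an acyclic digraph on Fin n, n ≥ 1.  A directed spanning tree of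
-- the complement with root r is the same thing as a self-map g of Fin n with
-- g r = r, all of whose orbits end in r, and with no v → g v (v ≠ r) an arrow
-- of D.  Call a map admissible if no v → g v is an arrow of D; since D has no
-- loops there are exactly ∏ d(v) of them.  So the theorem says
--     n · #(tree maps) = #(admissible maps).
-- Fix a rank on the vertices that increases along the arrows of D, with top
-- of maximal rank.  Then top may point anywhere, so #(admissible maps) is n
-- times the number of admissible maps fixing top.  Tree maps and maps fixing
-- top are both "good" maps: admissible, the orbit of top ends in a fixed root,
-- and all other cycles lie below the path from top to the root.  Tree maps
-- are the good maps without such a cycle, maps fixing top the good maps with
-- root top, and two explicit moves (forward: open the highest cycle and hang
-- it below the root; backward: close the path behind its lowest vertex) are
-- inverse bijections between the remaining good maps of either kind.

walk-length : ∀ {n} {G : Digraph n} {u v} → Walk G u v → ℕ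
walk-length nil = 0
walk-length (cons _ p) = suc (walk-length p)

module ListCounting where

  open import Data.Nat using (zero; suc; _+_; _*_)
  open import Data.Nat.Properties using (+-suc)
  open import Data.Fin using (Fin)
  import Data.Fin as Fin
  open import Data.Vec using (Vec; []; _∷_; lookup)
  open import Data.Vec.Properties using (∷-injective)
  open import Data.List using (List; []; _∷_; [_]; _++_; map; length; filter; tabulate; cartesianProductWith)
  open import Data.List.Properties using (length-++; length-map)
  open import Data.List.Membership.Propositional using (_∈_)
  open import Data.List.Membership.Propositional.Properties using (∈-map⁺; ∈-map⁻; ∈-cartesianProductWith⁺; ∈-cartesianProductWith⁻)
  open import Data.List.Relation.Unary.Any using (here; there)
  open import Data.List.Relation.Unary.All as All using ([])
  import Data.List.Relation.Unary.All.Properties as AllP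
  open import Data.List.Relation.Unary.Unique.Propositional using (Unique; []; _∷_)
  open import Data.List.Relation.Unary.Unique.Propositional.Properties using (cartesianProductWith⁺)
  open import Data.List.Relation.Binary.BagAndSetEquality using (∼bag⇒↭)
  open import Data.List.Membership.Propositional.Properties.WithK using (unique∧set⇒bag)
  open import Data.List.Relation.Binary.Permutation.Propositional.Properties using (↭-length)
  open import Data.Nat.ListAction using (product)
  open import Data.Product using (_,_)
  open import Function.Bundles using (_⇔_; mk⇔)
  open import Relation.Nullary using (yes; no; ¬?)
  open import Relation.Unary using (Decidable)
  open import Relation.Binary.PropositionalEquality using (_≡_; refl; sym; trans; cong; cong₂; subst; module ≡-Reasoning)

  length-cartesianProductWith : ∀ {A B C : Set} (f : A → B → C) (xs : List A) (ys : List B) →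
    length (cartesianProductWith f xs ys) ≡ length xs * length ys
  length-cartesianProductWith f [] ys = refl
  length-cartesianProductWith f (x ∷ xs) ys = begin
    length (map (f x) ys ++ cartesianProductWith f xs ys)
      ≡⟨ length-++ (map (f x) ys) ⟩
    length (map (f x) ys) + length (cartesianProductWith f xs ys)
      ≡⟨ cong₂ _+_ (length-map (f x) ys) (length-cartesianProductWith f xs ys) ⟩
    length ys + length xs * length ys ∎
    where open ≡-Reasoning

  choices : ∀ {A : Set} k → (Fin k → List A) → List (Vec A k)
  choices zero c = [ [] ]
  choices (suc k) c = cartesianProductWith _∷_ (c Fin.zero) (choices k (λ i → c (Fin.suc i)))

  length-choices : ∀ {A : Set} k (c : Fin k → List A) →
    length (choices k c) ≡ product (tabulate (λ i → length (c i)))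
  length-choices zero c = refl
  length-choices (suc k) c =
    trans (length-cartesianProductWith _∷_ (c Fin.zero) _)
          (cong (length (c Fin.zero) *_) (length-choices k _))

  ∈-choices⁺ : ∀ {A : Set} k (c : Fin k → List A) (v : Vec A k) →
    (∀ i → lookup v i ∈ c i) → v ∈ choices k c
  ∈-choices⁺ zero c [] h = here refl
  ∈-choices⁺ (suc k) c (x ∷ v) h =
    ∈-cartesianProductWith⁺ _∷_ (h Fin.zero) (∈-choices⁺ k _ v (λ i → h (Fin.suc i)))

  ∈-choices⁻ : ∀ {A : Set} k (c : Fin k → List A) (v : Vec A k) →
    v ∈ choices k c → ∀ i → lookup v i ∈ c i
  ∈-choices⁻ (suc k) c v p i with ∈-cartesianProductWith⁻ _∷_ (c Fin.zero) (choices k _) p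
  ∈-choices⁻ (suc k) c .(x ∷ w) p Fin.zero    | x , w , x∈ , w∈ , refl = x∈
  ∈-choices⁻ (suc k) c .(x ∷ w) p (Fin.suc i) | x , w , x∈ , w∈ , refl = ∈-choices⁻ k _ w w∈ i

  choices-unique : ∀ {A : Set} k (c : Fin k → List A) → (∀ i → Unique (c i)) → Unique (choices k c)
  choices-unique zero c u = [] ∷ []
  choices-unique (suc k) c u =
    cartesianProductWith⁺ _∷_ ∷-injective (u Fin.zero) (choices-unique k _ (λ i → u (Fin.suc i)))

  map-unique : ∀ {A B : Set} (φ : A → B) {xs : List A} → Unique xs →
    (∀ {x y} → x ∈ xs → y ∈ xs → φ x ≡ φ y → x ≡ y) → Unique (map φ xs)
  map-unique φ {[]} u inj = []
  map-unique φ {x ∷ xs} (x∉ ∷ u) inj =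
    AllP.map⁺ (All.tabulate (λ {y} y∈ e → All.lookup x∉ y∈ (inj (here refl) (there y∈) e)))
    ∷ map-unique φ u (λ p q → inj (there p) (there q))

  bijection-length : ∀ {A B : Set} (xs : List A) (ys : List B) → Unique xs → Unique ys →
    (φ : A → B) (ψ : B → A) →
    (∀ {x} → x ∈ xs → φ x ∈ ys) → (∀ {y} → y ∈ ys → ψ y ∈ xs) →
    (∀ {x} → x ∈ xs → ψ (φ x) ≡ x) → (∀ {y} → y ∈ ys → φ (ψ y) ≡ y) →
    length xs ≡ length ys
  bijection-length xs ys ux uy φ ψ φ∈ ψ∈ ψφ φψ =
    trans (sym (length-map φ xs)) (↭-length (∼bag⇒↭ (unique∧set⇒bag image-unique uy same-members)))
    where
    image-unique : Unique (map φ xs)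
    image-unique = map-unique φ ux (λ p q e → trans (sym (ψφ p)) (trans (cong ψ e) (ψφ q)))
    image⊆ : ∀ {z} → z ∈ map φ xs → z ∈ ys
    image⊆ p with ∈-map⁻ φ p
    ... | x , x∈ , refl = φ∈ x∈
    same-members : ∀ {z} → z ∈ map φ xs ⇔ z ∈ ys
    same-members = mk⇔ image⊆ (λ p → subst (_∈ map φ xs) (φψ p) (∈-map⁺ φ (ψ∈ p)))

  length-filter-split : ∀ {A : Set} {P : A → Set} (P? : Decidable P) (xs : List A) →
    length (filter P? xs) + length (filter (λ x → ¬? (P? x)) xs) ≡ length xs
  length-filter-split P? [] = refl
  length-filter-split P? (x ∷ xs) with P? x
  ... | yes _ = cong suc (length-filter-split P? xs)
  ... | no _ = trans (+-suc (length (filter P? xs)) _) (cong suc (length-filter-split P? xs))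

module Search where

  open import Data.Nat using (ℕ; zero; suc; _≤_; _<_; z≤n; s≤s; s≤s⁻¹)
  open import Data.Nat.Properties using (n<1+n)
  open import Data.Fin using (Fin; toℕ)
  open import Data.Fin.Properties using (pigeonhole; toℕ<n)
  open import Data.List using (List; []; _∷_; filter; allFin)
  open import Data.List.Extrema.Nat using (argmax; argmin; argmax-sel; argmin-sel; f[xs]≤f[argmax]; f[⊥]≤f[argmax]; f[argmin]≤f[xs]; f[argmin]≤f[⊤])
  open import Data.List.Membership.Propositional using (_∈_)
  open import Data.List.Membership.Propositional.Properties using (∈-filter⁺; ∈-filter⁻; ∈-allFin)
  open import Data.List.Relation.Unary.Any using (here; there)
  open import Data.List.Relation.Unary.All as All using (All)
  open import Data.Product using (Σ; _×_; _,_; proj₂)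
  open import Data.Sum using (_⊎_; inj₁; inj₂)
  open import Relation.Nullary using (¬_; Dec; yes; no)
  open import Relation.Unary using (Decidable)
  open import Relation.Binary.PropositionalEquality using (_≡_; refl)

  sequence-collision : ∀ {n} (s : ℕ → Fin n) → Σ ℕ λ i → Σ ℕ λ j → i < j × j ≤ n × s i ≡ s j
  sequence-collision {n} s with pigeonhole (n<1+n n) (λ x → s (toℕ x))
  ... | x , y , x<y , e = toℕ x , toℕ y , x<y , s≤s⁻¹ (toℕ<n y) , e

  -- Least number principle: a witness below m yields a least witness.
  -- (Abstract: only the specification is ever used, and unfolding the
  -- search during type checking is expensive.)
  abstract
    least : (P : ℕ → Set) → (∀ m → Dec (P m)) → ∀ m → P m →
      Σ ℕ λ j → P j × j ≤ m × (∀ i → i < j → ¬ P i)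
    least P P? zero p = 0 , p , z≤n , λ i ()
    least P P? (suc m) p with P? 0
    ... | yes p0 = 0 , p0 , z≤n , λ i ()
    ... | no ¬p0 with least (λ i → P (suc i)) (λ i → P? (suc i)) m p
    ... | j , pj , j≤m , below = suc j , pj , s≤s j≤m , below′
      where
      below′ : ∀ i → i < suc j → ¬ P i
      below′ zero _ = ¬p0
      below′ (suc i) i<j = below i (s≤s⁻¹ i<j)

  module _ {A : Set} (f : A → ℕ) (default : A) where

    argmaxIn argminIn : List A → A
    argmaxIn [] = default
    argmaxIn (x ∷ xs) = argmax f x xs
    argminIn [] = default
    argminIn (x ∷ xs) = argmin f x xs

    private
      selected : ∀ {x : A} {xs m} → (m ≡ x) ⊎ (m ∈ xs) → m ∈ (x ∷ xs)
      selected (inj₁ refl) = here refl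
      selected (inj₂ p) = there p

    argmaxIn-spec : ∀ {xs y} → y ∈ xs → argmaxIn xs ∈ xs × All (λ x → f x ≤ f (argmaxIn xs)) xs
    argmaxIn-spec {x ∷ xs} _ = selected (argmax-sel f x xs) , f[⊥]≤f[argmax] {f = f} x xs All.∷ f[xs]≤f[argmax] x xs

    argminIn-spec : ∀ {xs y} → y ∈ xs → argminIn xs ∈ xs × All (λ x → f (argminIn xs) ≤ f x) xs
    argminIn-spec {x ∷ xs} _ = selected (argmin-sel f x xs) , f[argmin]≤f[⊤] {f = f} x xs All.∷ f[argmin]≤f[xs] x xs

  module _ {n} {P : Fin n → Set} (P? : Decidable P) (f : Fin n → ℕ) (default : Fin n) where

    private
      satisfying : List (Fin n)
      satisfying = filter P? (allFin n)

      satisfying⁺ : ∀ {c} → P c → c ∈ satisfying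
      satisfying⁺ pc = ∈-filter⁺ P? (∈-allFin _) pc

      satisfying⁻ : ∀ {c} → c ∈ satisfying → P c
      satisfying⁻ p = proj₂ (∈-filter⁻ P? {xs = allFin n} p)

    maxWhere minWhere : Fin n
    maxWhere = argmaxIn f default satisfying
    minWhere = argminIn f default satisfying

    maxWhere-spec : ∀ {c} → P c → P maxWhere × (∀ w → P w → f w ≤ f maxWhere)
    maxWhere-spec pc with argmaxIn-spec f default (satisfying⁺ pc)
    ... | m∈ , bound = satisfying⁻ m∈ , λ w pw → All.lookup bound (satisfying⁺ pw)

    minWhere-spec : ∀ {c} → P c → P minWhere × (∀ w → P w → f minWhere ≤ f w)
    minWhere-spec pc with argminIn-spec f default (satisfying⁺ pc)
    ... | m∈ , bound = satisfying⁻ m∈ , λ w pw → All.lookup bound (satisfying⁺ pw)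

module Iteration (n : ℕ) where

  open import Data.Nat using (ℕ; zero; suc; _+_; _∸_; _*_; _≤_; _<_; s≤s; s≤s⁻¹)
  open import Data.Nat.Properties hiding (_≟_)
  open import Data.Nat.DivMod using (_%_; _/_; m≡m%n+[m/n]*n; m%n<n)
  open import Data.Fin using (Fin)
  open import Data.Fin.Properties using (_≟_)
  open import Relation.Nullary using (yes; no)
  open Search using (sequence-collision)
  open import Data.Vec using (Vec; lookup; _[_]≔_)
  open import Data.Vec.Properties using (lookup∘update; lookup∘update′)
  open import Data.Vec.Relation.Binary.Pointwise.Extensional using (ext; Pointwise-≡⇒≡)
  open import Data.Product using (Σ; _×_; _,_)
  open import Data.Empty using (⊥-elim)
  open import Relation.Binary.Definitions using (tri<; tri≈; tri>)
  open import Relation.Binary.PropositionalEquality using (_≡_; _≢_; refl; sym; trans; cong; subst; module ≡-Reasoning)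

  Fun : Set
  Fun = Vec (Fin n) n

  infixl 9 _!_
  _!_ : Fun → Fin n → Fin n
  g ! v = lookup g v

  fun-ext : ∀ {g h} → (∀ v → g ! v ≡ h ! v) → g ≡ h
  fun-ext agree = Pointwise-≡⇒≡ (ext agree)

  -- g [ x ↦ y ] is g redirected to send x to y.  (Abstract: only the two
  -- lemmas below are used, and unfolding the table update is expensive.)
  infixl 10 _[_↦_]
  abstract
    _[_↦_] : Fun → Fin n → Fin n → Fun
    g [ x ↦ y ] = g [ x ]≔ y

    update-at : ∀ g x y → g [ x ↦ y ] ! x ≡ y
    update-at g x y = lookup∘update x g y

    update-off : ∀ g x y {v} → v ≢ x → g [ x ↦ y ] ! v ≡ g ! v
    update-off g x y v≢x = lookup∘update′ v≢x g y

  restore : ∀ g h x y → (∀ {v} → v ≢ x → v ≢ y → h ! v ≡ g ! v) → h [ y ↦ g ! y ] [ x ↦ g ! x ] ≡ g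
  restore g h x y same = fun-ext pointwise
    where
    pointwise : ∀ v → h [ y ↦ g ! y ] [ x ↦ g ! x ] ! v ≡ g ! v
    pointwise v with v ≟ x
    ... | yes refl = update-at (h [ y ↦ g ! y ]) v (g ! v)
    ... | no v≢x with v ≟ y
    ...   | yes refl = trans (update-off (h [ y ↦ g ! y ]) x (g ! x) v≢x) (update-at h v (g ! v))
    ...   | no v≢y = trans (update-off (h [ y ↦ g ! y ]) x (g ! x) v≢x) (trans (update-off h y (g ! y) v≢y) (same v≢x v≢y))

  iter : Fun → ℕ → Fin n → Fin n
  iter g zero v = v
  iter g (suc k) v = g ! iter g k v

  iter-+ : ∀ g i j v → iter g (i + j) v ≡ iter g i (iter g j v)
  iter-+ g zero j v = refl
  iter-+ g (suc i) j v = cong (g !_) (iter-+ g i j v)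

  iter-suc′ : ∀ g k v → iter g (suc k) v ≡ iter g k (g ! v)
  iter-suc′ g k v = trans (cong (λ z → iter g z v) (+-comm 1 k)) (iter-+ g k 1 v)

  iter-comm : ∀ g i j v → iter g i (iter g j v) ≡ iter g j (iter g i v)
  iter-comm g i j v = trans (sym (iter-+ g i j v)) (trans (cong (λ z → iter g z v) (+-comm i j)) (iter-+ g j i v))

  iter-fixed : ∀ g {r} → g ! r ≡ r → ∀ k → iter g k r ≡ r
  iter-fixed g e zero = refl
  iter-fixed g e (suc k) = trans (cong (g !_) (iter-fixed g e k)) e

  is-fixed : ∀ g {r x} → g ! r ≡ r → x ≡ r → x ≡ g ! x
  is-fixed g f refl = sym f

  iter-stays : ∀ g {r v k m} → g ! r ≡ r → iter g k v ≡ r → k ≤ m → iter g m v ≡ r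
  iter-stays g {r} {v} {k} {m} e p k≤m = begin
    iter g m v                   ≡⟨ cong (λ z → iter g z v) (sym (m∸n+n≡m k≤m)) ⟩
    iter g (m ∸ k + k) v         ≡⟨ iter-+ g (m ∸ k) k v ⟩
    iter g (m ∸ k) (iter g k v)  ≡⟨ cong (iter g (m ∸ k)) p ⟩
    iter g (m ∸ k) r             ≡⟨ iter-fixed g e (m ∸ k) ⟩
    r                            ∎
    where open ≡-Reasoning

  iter-agree : ∀ g h v k → (∀ j → j < k → h ! iter g j v ≡ g ! iter g j v) → iter h k v ≡ iter g k v
  iter-agree g h v zero a = refl
  iter-agree g h v (suc k) a =
    trans (cong (h !_) (iter-agree g h v k (λ j j<k → a j (m<n⇒m<1+n j<k)))) (a k ≤-refl)

  periodic-multiple : ∀ g {v} p → iter g p v ≡ v → ∀ c → iter g (c * p) v ≡ v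
  periodic-multiple g p e zero = refl
  periodic-multiple g {v} p e (suc c) =
    trans (iter-+ g p (c * p) v) (trans (cong (iter g p) (periodic-multiple g p e c)) e)

  -- on a cycle of length suc k every iterate is one of the first suc k
  -- (abstract: unfolding the division during type checking is expensive)
  abstract
    periodic-mod : ∀ g {v} k → iter g (suc k) v ≡ v → ∀ m → Σ ℕ λ r → r ≤ k × iter g m v ≡ iter g r v
    periodic-mod g {v} k e m = m % suc k , s≤s⁻¹ (m%n<n m (suc k)) , (begin
      iter g m v                                       ≡⟨ cong (λ z → iter g z v) (m≡m%n+[m/n]*n m (suc k)) ⟩
      iter g (m % suc k + m / suc k * suc k) v         ≡⟨ iter-+ g (m % suc k) (m / suc k * suc k) v ⟩
      iter g (m % suc k) (iter g (m / suc k * suc k) v) ≡⟨ cong (iter g (m % suc k)) (periodic-multiple g (suc k) e (m / suc k)) ⟩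
      iter g (m % suc k) v                             ∎)
      where open ≡-Reasoning

  periodic-orbit : ∀ g {v} p → iter g p v ≡ v → ∀ m → iter g p (iter g m v) ≡ iter g m v
  periodic-orbit g {v} p e m = trans (iter-comm g p m v) (cong (iter g m) e)

  periodic-fixed : ∀ g {v r} p → iter g (suc p) v ≡ v → g ! r ≡ r → ∀ m → iter g m v ≡ r → v ≡ r
  periodic-fixed g {v} p e f m q =
    trans (sym (periodic-multiple g (suc p) e m)) (iter-stays g f q (m≤m*n m (suc p)))

  -- g is injective on a cycle: the predecessor of a cycle point is on the cycle
  cycle-injective : ∀ g {a} k → iter g (suc k) a ≡ a →
    ∀ i j → g ! iter g i a ≡ g ! iter g j a → iter g i a ≡ iter g j a
  cycle-injective g {a} k per i j e = begin
    iter g i a                    ≡⟨ sym (periodic-orbit g (suc k) per i) ⟩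
    iter g (suc k) (iter g i a)   ≡⟨ iter-suc′ g k (iter g i a) ⟩
    iter g k (g ! iter g i a)     ≡⟨ cong (iter g k) e ⟩
    iter g k (g ! iter g j a)     ≡⟨ sym (iter-suc′ g k (iter g j a)) ⟩
    iter g (suc k) (iter g j a)   ≡⟨ periodic-orbit g (suc k) per j ⟩
    iter g j a                    ∎
    where open ≡-Reasoning

  orbit-collision : ∀ g v → Σ ℕ λ i → Σ ℕ λ d → suc d + i ≤ n × iter g i v ≡ iter g (suc d + i) v
  orbit-collision g v with sequence-collision (λ i → iter g i v)
  ... | i , j , i<j , j≤n , e with m≤n⇒∃[o]m+o≡n i<j
  ... | d , refl = i , d , subst (_≤ n) j≡ j≤n , trans e (cong (λ z → iter g z v) j≡)
    where
    j≡ : suc i + d ≡ suc d + i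
    j≡ = cong suc (+-comm i d)

  collision-fixed : ∀ g {r v} K i d → g ! r ≡ r → iter g K v ≡ r →
    iter g i v ≡ iter g (suc d + i) v → iter g i v ≡ r
  collision-fixed g {r} {v} K i d f reach e = periodic-fixed g d periodic f K reaches
    where
    periodic : iter g (suc d) (iter g i v) ≡ iter g i v
    periodic = sym (trans e (iter-+ g (suc d) i v))
    reaches : iter g K (iter g i v) ≡ r
    reaches = trans (iter-comm g K i v) (trans (cong (iter g i) reach) (iter-fixed g f i))

  reaches-within-n : ∀ g {r v} K → g ! r ≡ r → iter g K v ≡ r → iter g n v ≡ r
  reaches-within-n g {v = v} K f reach with orbit-collision g v
  ... | i , d , bound , e =
    iter-stays g f (collision-fixed g K i d f reach e) (≤-trans (m≤n+m i (suc d)) bound)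

  eventually-periodic : ∀ g v → Σ ℕ λ d → d < n × iter g (suc d) (iter g n v) ≡ iter g n v
  eventually-periodic g v with orbit-collision g v
  ... | i , d , bound , e = d , ≤-trans (s≤s (m≤m+n d i)) bound , (begin
    iter g (suc d) (iter g n v)               ≡⟨ cong (λ z → iter g (suc d) (iter g z v)) (sym (m∸n+n≡m i≤n)) ⟩
    iter g (suc d) (iter g (n ∸ i + i) v)     ≡⟨ cong (iter g (suc d)) (iter-+ g (n ∸ i) i v) ⟩
    iter g (suc d) (iter g (n ∸ i) (iter g i v)) ≡⟨ periodic-orbit g (suc d) (sym (trans e (iter-+ g (suc d) i v))) (n ∸ i) ⟩
    iter g (n ∸ i) (iter g i v)               ≡⟨ sym (iter-+ g (n ∸ i) i v) ⟩
    iter g (n ∸ i + i) v                      ≡⟨ cong (λ z → iter g z v) (m∸n+n≡m i≤n) ⟩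
    iter g n v                                ∎)
    where
    open ≡-Reasoning
    i≤n : i ≤ n
    i≤n = ≤-trans (m≤n+m i (suc d)) bound

  image-collision-fixed : ∀ g {r v} K → g ! r ≡ r → iter g K v ≡ r → ∀ {i j} → i < j →
    g ! iter g i v ≡ g ! iter g j v → iter g j v ≡ r
  image-collision-fixed g {v = v} K f reach {i} i<j e with m≤n⇒∃[o]m+o≡n i<j
  ... | d , refl = iter-stays g f (collision-fixed g K (suc i) d f reach e′) (m≤m+n (suc i) d)
    where
    e′ : iter g (suc i) v ≡ iter g (suc d + suc i) v
    e′ = trans e (cong (λ z → iter g (suc z) v) (+-comm (suc i) d))

  orbit-injective : ∀ g {r v} K → g ! r ≡ r → iter g K v ≡ r → ∀ i j →
    g ! iter g i v ≡ g ! iter g j v →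
    iter g i v ≢ g ! iter g i v → iter g j v ≢ g ! iter g j v → iter g i v ≡ iter g j v
  orbit-injective g {r} {v} K f reach i j e ni nj with <-cmp i j
  ... | tri≈ _ refl _ = refl
  ... | tri< i<j _ _ = ⊥-elim (nj (is-fixed g f (image-collision-fixed g K f reach i<j e)))
  ... | tri> _ _ j<i = ⊥-elim (ni (is-fixed g f (image-collision-fixed g K f reach j<i (sym e))))

record Ranked {n : ℕ} (D : Digraph n) : Set where
  field
    rank           : Fin n → ℕ
    rank-injective : ∀ {u v} → rank u ≡ rank v → u ≡ v
    rank-arrow     : ∀ {u v} → Arrow D u v → rank u < rank v
    top            : Fin n
    top-max        : ∀ v → rank v ≤ rank top

-- The rank of v is (the length of a longest walk ending at v,
-- which is < n because walks never revisit a vertex) · n + v.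
module Ranking {n : ℕ} (D : Digraph n) (acyclic : Acyclic D) where

  open import Data.Nat using (zero; suc; _+_; _*_; _≤_; _<_; z≤n; s≤s; s≤s⁻¹)
  open import Data.Nat.Properties
  open import Data.Bool using (Bool; true; false; if_then_else_)
  open import Data.Fin using (Fin; toℕ; fromℕ<)
  open import Data.Fin.Properties using (toℕ<n; toℕ-injective)
  open import Data.Vec using (lookup)
  open import Data.List using (map; allFin)
  open import Data.List.Extrema.Nat using (max; argmax-sel; xs≤max; max≤v⁺)
  open import Data.List.Membership.Propositional using (_∈_)
  open import Data.List.Membership.Propositional.Properties using (∈-map⁺; ∈-map⁻; ∈-allFin)
  open import Data.List.Relation.Unary.All as All using ()
  open import Data.Product using (Σ; _,_; proj₂)
  open import Data.Sum using (inj₁; inj₂)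
  open import Data.Empty using (⊥; ⊥-elim)
  open import Relation.Nullary using (yes; no)
  open import Relation.Binary.Definitions using (tri<; tri≈; tri>)
  open import Relation.Binary.PropositionalEquality using (_≡_; refl; sym; trans; cong; subst)
  open Search using (sequence-collision; argmaxIn; argmaxIn-spec)

  snoc : ∀ {u v w} → Walk D u v → Arrow D v w → Walk D u w
  snoc nil a = cons a nil
  snoc (cons b p) a = cons b (snoc p a)

  walk-length-snoc : ∀ {u v w} (p : Walk D u v) (a : Arrow D v w) → walk-length (snoc p a) ≡ suc (walk-length p)
  walk-length-snoc nil a = refl
  walk-length-snoc (cons b p) a = cong suc (walk-length-snoc p a)

  -- the i-th vertex of a walk (its end vertex once i exceeds its length),
  -- and the initial segment of the walk up to it
  vertexAt : ∀ {u v} → Walk D u v → ℕ → Fin n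
  vertexAt {u} p zero = u
  vertexAt {v = v} nil (suc i) = v
  vertexAt (cons _ p) (suc i) = vertexAt p i

  prefix : ∀ {u v} (p : Walk D u v) i → Walk D u (vertexAt p i)
  prefix p zero = nil
  prefix nil (suc i) = nil
  prefix (cons a p) (suc i) = cons a (prefix p i)

  no-revisit : ∀ {u v} (p : Walk D u v) {i j} → i < j → j ≤ walk-length p → vertexAt p i ≡ vertexAt p j → ⊥
  no-revisit (cons {u} {w} a p) {zero} {suc j} _ _ e = acyclic u w a (subst (Walk D w) (sym e) (prefix p j))
  no-revisit (cons a p) {suc i} {suc j} i<j j≤ e = no-revisit p (s≤s⁻¹ i<j) (s≤s⁻¹ j≤) e

  walk-short : ∀ {u v} (p : Walk D u v) → walk-length p < n
  walk-short p with walk-length p <? n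
  ... | yes short = short
  ... | no long with sequence-collision (vertexAt p)
  ... | i , j , i<j , j≤n , e = ⊥-elim (no-revisit p i<j (≤-trans j≤n (≮⇒≥ long)) e)

  E : Fin n → Fin n → Bool
  E u v = lookup (lookup D u) v

  -- height k v: the length of a longest walk of at most k arrows ending at
  -- v; an arrow u → v contributes one more than the height of u
  height : ℕ → Fin n → ℕ
  contribution : ℕ → Fin n → Fin n → ℕ
  height zero v = 0
  height (suc k) v = max 0 (map (contribution k v) (allFin n))
  contribution k v u = if E u v then suc (height k u) else 0

  contribution-arrow : ∀ k {u v} → Arrow D u v → contribution k v u ≡ suc (height k u)
  contribution-arrow k a rewrite a = refl

  height-arrow : ∀ k {u v} → Arrow D u v → suc (height k u) ≤ height (suc k) v
  height-arrow k {u} {v} a =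
    subst (_≤ height (suc k) v) (contribution-arrow k a)
      (All.lookup (xs≤max 0 (map (contribution k v) (allFin n))) (∈-map⁺ (contribution k v) (∈-allFin u)))

  height-walk : ∀ k v → Σ (Fin n) λ u → Σ (Walk D u v) λ p → walk-length p ≡ height k v
  height-walk zero v = v , nil , refl
  height-walk (suc k) v with argmax-sel (λ x → x) 0 (map (contribution k v) (allFin n))
  ... | inj₁ e = v , nil , sym e
  ... | inj₂ m∈ with ∈-map⁻ (contribution k v) m∈
  ... | u , _ , e = attained u e
    where
    attained : ∀ u → height (suc k) v ≡ contribution k v u → Σ (Fin n) λ w → Σ (Walk D w v) λ p → walk-length p ≡ height (suc k) v
    attained u e with E u v in a
    ... | false = v , nil , sym e
    ... | true with height-walk k u
    ... | w , p , len = w , snoc p a , trans (walk-length-snoc p a) (trans (cong suc len) (sym e))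

  walk-height : ∀ {u v} (p : Walk D u v) k → height k u + walk-length p ≤ height (k + walk-length p) v
  walk-height {u} nil k rewrite +-identityʳ k | +-identityʳ (height k u) = ≤-refl
  walk-height {u} {v} (cons {w = w} a p) k = begin
    height k u + suc (walk-length p)      ≡⟨ +-suc (height k u) (walk-length p) ⟩
    suc (height k u) + walk-length p      ≤⟨ +-monoˡ-≤ (walk-length p) (height-arrow k a) ⟩
    height (suc k) w + walk-length p      ≤⟨ walk-height p (suc k) ⟩
    height (suc k + walk-length p) v      ≡⟨ cong (λ z → height z v) (sym (+-suc k (walk-length p))) ⟩
    height (k + suc (walk-length p)) v    ∎
    where open ≤-Reasoning

  height-step : ∀ k v → height k v ≤ height (suc k) v
  height-step zero v = z≤n
  height-step (suc k) v =
    max≤v⁺ z≤n (All.tabulate bounded)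
    where
    larger : ∀ u → contribution k v u ≤ contribution (suc k) v u
    larger u with E u v
    ... | true = s≤s (height-step k u)
    ... | false = z≤n
    bounded : ∀ {x} → x ∈ map (contribution k v) (allFin n) → x ≤ height (suc (suc k)) v
    bounded x∈ with ∈-map⁻ (contribution k v) x∈
    ... | u , _ , refl = ≤-trans (larger u)
      (All.lookup (xs≤max 0 (map (contribution (suc k) v) (allFin n))) (∈-map⁺ (contribution (suc k) v) (∈-allFin u)))

  height-mono : ∀ {k m} v → k ≤ m → height k v ≤ height m v
  height-mono {k} {m} v k≤m with m≤n⇒∃[o]m+o≡n k≤m
  ... | d , refl = more d
    where
    more : ∀ d → height k v ≤ height (k + d) v
    more zero rewrite +-identityʳ k = ≤-refl
    more (suc d) rewrite +-suc k d = ≤-trans (more d) (height-step (k + d) v)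

  -- all walks are shorter than n, so the height is stable after n steps
  height-stable : ∀ v → height (suc n) v ≤ height n v
  height-stable v with height-walk (suc n) v
  ... | u , p , len = begin
    height (suc n) v           ≡⟨ sym len ⟩
    walk-length p              ≤⟨ walk-height p 0 ⟩
    height (walk-length p) v   ≤⟨ height-mono v (<⇒≤ (walk-short p)) ⟩
    height n v                 ∎
    where open ≤-Reasoning

  height-increases : ∀ {u v} → Arrow D u v → height n u < height n v
  height-increases {u} {v} a = ≤-trans (height-arrow n a) (height-stable v)

  rank : Fin n → ℕ
  rank v = height n v * n + toℕ v

  rank-compare : ∀ {u v} → height n u < height n v → rank u < rank v
  rank-compare {u} {v} lt = begin-strict
    height n u * n + toℕ u   <⟨ +-monoʳ-< (height n u * n) (toℕ<n u) ⟩
    height n u * n + n       ≡⟨ +-comm (height n u * n) n ⟩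
    suc (height n u) * n     ≤⟨ *-monoˡ-≤ n lt ⟩
    height n v * n           ≤⟨ m≤m+n (height n v * n) (toℕ v) ⟩
    height n v * n + toℕ v   ∎
    where open ≤-Reasoning

  rank-arrow : ∀ {u v} → Arrow D u v → rank u < rank v
  rank-arrow a = rank-compare (height-increases a)

  rank-injective : ∀ {u v} → rank u ≡ rank v → u ≡ v
  rank-injective {u} {v} e with <-cmp (height n u) (height n v)
  ... | tri< lt _ _ = ⊥-elim (<-irrefl e (rank-compare lt))
  ... | tri> _ _ gt = ⊥-elim (<-irrefl (sym e) (rank-compare gt))
  ... | tri≈ _ same _ = toℕ-injective (+-cancelˡ-≡ (height n u * n) _ _
                          (trans e (cong (λ h → h * n + toℕ v) (sym same))))

  ranked : 1 ≤ n → Ranked D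
  ranked n≥1 = record
    { rank = rank ; rank-injective = rank-injective ; rank-arrow = rank-arrow
    ; top = top ; top-max = top-max }
    where
    top : Fin n
    top = argmaxIn rank (fromℕ< n≥1) (allFin n)
    top-max : ∀ v → rank v ≤ rank top
    top-max v = All.lookup (proj₂ (argmaxIn-spec rank (fromℕ< n≥1) (∈-allFin v))) (∈-allFin v)

module Core {n : ℕ} {D : Digraph n} (R : Ranked D) where

  open Ranked R
  open Iteration n public
  open Search using (least; maxWhere; minWhere; maxWhere-spec; minWhere-spec)

  open import Data.Nat using (zero; suc; _+_; _≤?_; _<?_; s≤s; z≤n)
  open import Data.Nat.Properties hiding (_≟_)
  open import Data.Bool using (true)
  import Data.Bool.Properties as Bool
  open import Data.Fin using (toℕ; fromℕ<)
  open import Data.Fin.Properties using (_≟_; all?; any?; toℕ-fromℕ<; toℕ<n)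
  open import Data.Vec using (lookup)
  open import Data.Product using (Σ; _×_; _,_; proj₁; proj₂)
  open import Data.Sum using (_⊎_; inj₁; inj₂)
  open import Data.Empty using (⊥-elim)
  open import Relation.Nullary using (¬_; Dec; yes; no; ¬?)
  open import Relation.Nullary.Decidable using (_×-dec_; _⊎-dec_; _→-dec_)
  open import Relation.Binary.PropositionalEquality using (_≢_; refl; sym; trans; cong; cong₂; subst; module ≡-Reasoning)

  -- Arrows of D go up in rank, so arrows going down (or loops) are never in D.
  no-arrow-down : ∀ {v w} → rank w ≤ rank v → ¬ Arrow D v w
  no-arrow-down le a = <⇒≱ (rank-arrow a) le

  below-top : ∀ {v} → v ≢ top → rank v < rank top
  below-top ne = ≤∧≢⇒< (top-max _) (λ e → ne (rank-injective e))

  Arrow? : ∀ v w → Dec (Arrow D v w)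
  Arrow? v w = lookup (lookup D v) w Bool.≟ true

  Admissible : Fun → Set
  Admissible g = ∀ v → ¬ Arrow D v (g ! v)

  Admissible? : ∀ g → Dec (Admissible g)
  Admissible? g = all? (λ v → ¬? (Arrow? v (g ! v)))

  admissible-update : ∀ g x y → Admissible g → rank y ≤ rank x → Admissible (g [ x ↦ y ])
  admissible-update g x y adm le v with v ≟ x
  ... | yes refl = subst (λ z → ¬ Arrow D v z) (sym (update-at g v y)) (no-arrow-down le)
  ... | no v≢x = subst (λ z → ¬ Arrow D v z) (sym (update-off g x y v≢x)) (adm v)

  -- the end of the orbit of top (a fixed point for the maps considered)
  root : Fun → Fin n
  root g = iter g n top

  OnCycle : Fun → Fin n → Set
  OnCycle g v = Σ (Fin n) λ k → iter g (suc (toℕ k)) v ≡ v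

  OnCycle? : ∀ g v → Dec (OnCycle g v)
  OnCycle? g v = any? (λ k → iter g (suc (toℕ k)) v ≟ v)

  CycleMin : Fun → Fin n → Set
  CycleMin g c = ∀ (k : Fin (suc n)) → rank c ≤ rank (iter g (toℕ k) c)

  Candidate : Fun → Fin n → Set
  Candidate g c = OnCycle g c × c ≢ root g × CycleMin g c

  Candidate? : ∀ g c → Dec (Candidate g c)
  Candidate? g c = OnCycle? g c ×-dec ¬? (c ≟ root g) ×-dec all? (λ k → rank c ≤? rank (iter g (toℕ k) c))

  HasCandidate : Fun → Set
  HasCandidate g = Σ (Fin n) (Candidate g)

  HasCandidate? : ∀ g → Dec (HasCandidate g)
  HasCandidate? g = any? (Candidate? g)

  OnPath : Fun → Fin n → Set
  OnPath g w = Σ (Fin n) λ i → iter g (suc (toℕ i)) top ≡ w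

  OnPath? : ∀ g w → Dec (OnPath g w)
  OnPath? g w = any? (λ i → iter g (suc (toℕ i)) top ≟ w)

  OnPath⁰ : Fun → Fin n → Set
  OnPath⁰ g u = u ≡ top ⊎ OnPath g u

  CyclesBelowPath : Fun → Set
  CyclesBelowPath g = ∀ c w → Candidate g c → OnPath g w → rank c < rank w

  Good : Fun → Set
  Good g = Admissible g × g ! root g ≡ root g × CyclesBelowPath g

  Good? : ∀ g → Dec (Good g)
  Good? g = Admissible? g ×-dec (g ! root g ≟ root g) ×-dec
    all? (λ c → all? (λ w → Candidate? g c →-dec (OnPath? g w →-dec (rank c <? rank w))))

  -- The choices made by the two moves.  They are abstract so that goals
  -- mention them by name; only their specifications are used.
  abstract
    topCandidate : Fun → Fin n
    topCandidate g = maxWhere (Candidate? g) rank top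

    topCandidate-spec : ∀ {g c} → Candidate g c →
      Candidate g (topCandidate g) × (∀ w → Candidate g w → rank w ≤ rank (topCandidate g))
    topCandidate-spec {g} = maxWhere-spec (Candidate? g) rank top

    cyclePred : Fun → Fin n → Fin n
    cyclePred g a with OnCycle? g a
    ... | yes (k , _) = iter g (toℕ k) a
    ... | no _ = a

    cyclePred-spec : ∀ g {a} → OnCycle g a → g ! cyclePred g a ≡ a × Σ ℕ (λ m → iter g m a ≡ cyclePred g a)
    cyclePred-spec g {a} c with OnCycle? g a
    ... | yes (k , e) = e , toℕ k , refl
    ... | no ¬c = ⊥-elim (¬c c)

    pathMin : Fun → Fin n
    pathMin g = minWhere (OnPath? g) rank top

    pathMin-spec : ∀ {g w} → OnPath g w → OnPath g (pathMin g) × (∀ w → OnPath g w → rank (pathMin g) ≤ rank w)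
    pathMin-spec {g} = minWhere-spec (OnPath? g) rank top

  PathPred : Fun → Fin n → Set
  PathPred g u = OnPath⁰ g u × g ! u ≡ pathMin g × u ≢ pathMin g

  abstract
    pathPred : Fun → Fin n
    pathPred g with any? (λ u → ((u ≟ top) ⊎-dec OnPath? g u) ×-dec (g ! u ≟ pathMin g) ×-dec ¬? (u ≟ pathMin g))
    ... | yes (u , _) = u
    ... | no _ = top

    pathPred-spec : ∀ {g u} → PathPred g u → PathPred g (pathPred g)
    pathPred-spec {g} {u} pu with any? (λ u → ((u ≟ top) ⊎-dec OnPath? g u) ×-dec (g ! u ≟ pathMin g) ×-dec ¬? (u ≟ pathMin g))
    ... | yes (_ , pv) = pv
    ... | no none = ⊥-elim (none (u , pu))

  -- Forward move: cut the top candidate's cycle open just before it, make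
  -- its predecessor the new root, and hang the cycle below the old root.
  forward : Fun → Fun
  forward g = g [ root g ↦ topCandidate g ] [ cyclePred g (topCandidate g) ↦ cyclePred g (topCandidate g) ]

  -- Backward move: make the lowest path vertex the successor of the root
  -- (closing a cycle) and make its predecessor on the path the new root.
  backward : Fun → Fun
  backward g = g [ root g ↦ pathMin g ] [ pathPred g ↦ pathPred g ]

  private
    n-pos : 1 ≤ n
    n-pos = ≤-trans (s≤s z≤n) (toℕ<n top)

    pred-n : Σ ℕ λ m → suc m ≡ n
    pred-n = m≤n⇒∃[o]m+o≡n n-pos

  -- the index i with suc i = n, so that the root itself is a path vertex
  last : Fin n
  last = fromℕ< (subst (proj₁ pred-n <_) (proj₂ pred-n) ≤-refl)

  last-index : suc (toℕ last) ≡ n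
  last-index = trans (cong suc (toℕ-fromℕ< _)) (proj₂ pred-n)

  root-onPath : ∀ g → OnPath g (root g)
  root-onPath g = last , cong (λ z → iter g z top) last-index

  onPath-iter : ∀ g → g ! root g ≡ root g → ∀ m {x} → iter g (suc m) top ≡ x → OnPath g x
  onPath-iter g fix m {x} e with m <? n
  ... | yes m<n = fromℕ< m<n , trans (cong (λ z → iter g (suc z) top) (toℕ-fromℕ< m<n)) e
  ... | no m≮n = last , trans (cong (λ z → iter g z top) last-index)
                   (trans (sym (iter-stays g fix refl (≤-trans (≮⇒≥ m≮n) (n≤1+n m)))) e)

  onPath⁰-iter : ∀ g → g ! root g ≡ root g → ∀ i → OnPath⁰ g (iter g i top)
  onPath⁰-iter g fix zero = inj₁ refl
  onPath⁰-iter g fix (suc i) = inj₂ (onPath-iter g fix i refl)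

  onPath⁰-index : ∀ {g u} → OnPath⁰ g u → Σ ℕ λ i → iter g i top ≡ u
  onPath⁰-index (inj₁ refl) = 0 , refl
  onPath⁰-index (inj₂ (i , e)) = suc (toℕ i) , e

  onCycle-intro : ∀ g {v} k → k < n → iter g (suc k) v ≡ v → OnCycle g v
  onCycle-intro g {v} k k<n e = fromℕ< k<n , trans (cong (λ z → iter g (suc z) v) (toℕ-fromℕ< k<n)) e

  cycle-orbit-bounded : ∀ {g c} → OnCycle g c → ∀ m → Σ (Fin (suc n)) λ s → iter g m c ≡ iter g (toℕ s) c
  cycle-orbit-bounded {g} {c} (k , per) m = bounded (periodic-mod g (toℕ k) per m)
    where
    bounded : Σ ℕ (λ r → r ≤ toℕ k × iter g m c ≡ iter g r c) → Σ (Fin (suc n)) λ s → iter g m c ≡ iter g (toℕ s) c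
    bounded (r , r≤k , e) = fromℕ< r< , trans e (cong (λ z → iter g z c) (sym (toℕ-fromℕ< r<)))
      where
      r< : r < suc n
      r< = s≤s (≤-trans r≤k (<⇒≤ (toℕ<n k)))

  cycleMin-all : ∀ {g c} → OnCycle g c → CycleMin g c → ∀ m → rank c ≤ rank (iter g m c)
  cycleMin-all {g} {c} cycle cm m =
    subst (λ z → rank c ≤ rank z) (sym (proj₂ (cycle-orbit-bounded {g} cycle m))) (cm (proj₁ (cycle-orbit-bounded {g} cycle m)))

  pathPred-unique : ∀ g → g ! root g ≡ root g → ∀ {u u′} → OnPath⁰ g u → OnPath⁰ g u′ →
    g ! u ≡ g ! u′ → u ≢ g ! u → u′ ≢ g ! u′ → u ≡ u′
  pathPred-unique g fix pu pu′ with onPath⁰-index {g} pu | onPath⁰-index {g} pu′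
  ... | i , refl | j , refl = orbit-injective g n fix refl i j

  candidate-exists : ∀ g {x} → g ! root g ≡ root g → OnCycle g x → x ≢ root g → HasCandidate g
  candidate-exists g {x} fix (k , per) x≢root =
    c , onCycle-intro g (toℕ k) (toℕ<n k) c-periodic , c≢root , c-min
    where
    OnOrbit : Fin n → Set
    OnOrbit w = Σ (Fin (suc n)) λ j → iter g (toℕ j) x ≡ w
    OnOrbit? : ∀ w → Dec (OnOrbit w)
    OnOrbit? w = any? (λ j → iter g (toℕ j) x ≟ w)
    c : Fin n
    c = minWhere OnOrbit? rank top
    c-spec : OnOrbit c × (∀ w → OnOrbit w → rank c ≤ rank w)
    c-spec = minWhere-spec OnOrbit? rank top (Data.Fin.zero , refl)
    j₀ : ℕ
    j₀ = toℕ (proj₁ (proj₁ c-spec))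
    c-from-x : iter g j₀ x ≡ c
    c-from-x = proj₂ (proj₁ c-spec)
    c-periodic : iter g (suc (toℕ k)) c ≡ c
    c-periodic = subst (λ z → iter g (suc (toℕ k)) z ≡ z) c-from-x (periodic-orbit g (suc (toℕ k)) per j₀)
    c≢root : c ≢ root g
    c≢root e = x≢root (periodic-fixed g (toℕ k) per fix j₀ (trans c-from-x e))
    c-min : CycleMin g c
    c-min m = subst (λ z → rank c ≤ rank z) shift (proj₂ c-spec _ (proj₁ bounded , sym (proj₂ bounded)))
      where
      bounded : Σ (Fin (suc n)) λ s → iter g (toℕ m + j₀) x ≡ iter g (toℕ s) x
      bounded = cycle-orbit-bounded {g} (k , per) (toℕ m + j₀)
      shift : iter g (toℕ m + j₀) x ≡ iter g (toℕ m) c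
      shift = trans (iter-+ g (toℕ m) j₀ x) (cong (iter g (toℕ m)) c-from-x)

  candidate-transfer : ∀ g h {c} → (∀ m → h ! iter h m c ≡ g ! iter h m c) → c ≢ root g →
    OnCycle h c → CycleMin h c → Candidate g c
  candidate-transfer g h {c} agree c≢root (k , per) cm =
    (k , trans (sym (same (suc (toℕ k)))) per) , c≢root , λ m → subst (λ z → rank c ≤ rank z) (same (toℕ m)) (cm m)
    where
    same : ∀ m → iter h m c ≡ iter g m c
    same zero = refl
    same (suc m) = trans (agree m) (cong (g !_) (same m))

  fixing-top-good : ∀ g → Admissible g → g ! top ≡ top → Good g × root g ≡ top
  fixing-top-good g adm fixed = (adm , fix , below) , root≡top
    where
    root≡top : root g ≡ top
    root≡top = iter-fixed g fixed n
    fix : g ! root g ≡ root g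
    fix = subst (λ z → g ! z ≡ z) (sym root≡top) fixed
    below : CyclesBelowPath g
    below c w (_ , c≢root , _) (i , e) =
      subst (λ z → rank c < rank z) (trans (sym (iter-fixed g fixed (suc (toℕ i)))) e)
        (below-top (λ c≡top → c≢root (trans c≡top (sym root≡top))))

  tree-good : ∀ g → Admissible g → g ! root g ≡ root g → (∀ v → iter g n v ≡ root g) →
    Good g × ¬ HasCandidate g
  tree-good g adm fix all-reach = (adm , fix , λ c w cc _ → ⊥-elim (none (c , cc))) , none
    where
    none : ¬ HasCandidate g
    none (c , (k , per) , c≢root , _) = c≢root (periodic-fixed g (toℕ k) per fix n (all-reach c))

  no-candidate-tree : ∀ g → Good g → ¬ HasCandidate g → ∀ v → iter g n v ≡ root g
  no-candidate-tree g (_ , fix , _) none v = by-cases (iter g n v ≟ root g)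
    where
    -- iter g n v is on a cycle, which would otherwise yield a candidate
    limit-cycle : Σ ℕ λ d → d < n × iter g (suc d) (iter g n v) ≡ iter g n v
    limit-cycle = eventually-periodic g v
    by-cases : Dec (iter g n v ≡ root g) → iter g n v ≡ root g
    by-cases (yes e) = e
    by-cases (no ne) = ⊥-elim (none (candidate-exists g fix
      (onCycle-intro g (proj₁ limit-cycle) (proj₁ (proj₂ limit-cycle)) (proj₂ (proj₂ limit-cycle))) ne))

  -- In g′ = forward g the path from top runs as before up to ρ, then through
  -- the cycle of a from a to ℓ, which is the new fixed root.
  module Forward (g : Fun) (good : Good g) (has : HasCandidate g) where

    adm : Admissible g
    adm = proj₁ good
    fix : g ! root g ≡ root g
    fix = proj₁ (proj₂ good)
    below : CyclesBelowPath g
    below = proj₂ (proj₂ good)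

    ρ : Fin n
    ρ = root g
    a : Fin n
    a = topCandidate g
    a-candidate : Candidate g a
    a-candidate = proj₁ (topCandidate-spec (proj₂ has))
    a-max : ∀ w → Candidate g w → rank w ≤ rank a
    a-max = proj₂ (topCandidate-spec (proj₂ has))
    ℓ : Fin n
    ℓ = cyclePred g a
    gℓ≡a : g ! ℓ ≡ a
    gℓ≡a = proj₁ (cyclePred-spec g (proj₁ a-candidate))
    mℓ : ℕ
    mℓ = proj₁ (proj₂ (cyclePred-spec g (proj₁ a-candidate)))
    a-to-ℓ : iter g mℓ a ≡ ℓ
    a-to-ℓ = proj₂ (proj₂ (cyclePred-spec g (proj₁ a-candidate)))
    k : ℕ
    k = toℕ (proj₁ (proj₁ a-candidate))
    a-periodic : iter g (suc k) a ≡ a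
    a-periodic = proj₂ (proj₁ a-candidate)

    cycle-avoids-root : ∀ m → iter g m a ≢ ρ
    cycle-avoids-root m e = proj₁ (proj₂ a-candidate) (periodic-fixed g k a-periodic fix m e)

    ℓ≢ρ : ℓ ≢ ρ
    ℓ≢ρ e = cycle-avoids-root mℓ (trans a-to-ℓ e)

    path-avoids-cycle : ∀ j m → iter g j top ≢ iter g m a
    path-avoids-cycle j m e = cycle-avoids-root m
      (periodic-fixed g k (periodic-orbit g (suc k) a-periodic m) fix n
        (subst (λ z → iter g n z ≡ ρ) e (trans (iter-comm g n j top) (iter-fixed g fix j))))

    a<top : rank a < rank top
    a<top = below-top (λ e → path-avoids-cycle 0 0 (sym e))

    g′ : Fun
    g′ = forward g

    g′ρ : g′ ! ρ ≡ a
    g′ρ = trans (update-off (g [ ρ ↦ a ]) ℓ ℓ (λ e → ℓ≢ρ (sym e))) (update-at g ρ a)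
    g′ℓ : g′ ! ℓ ≡ ℓ
    g′ℓ = update-at (g [ ρ ↦ a ]) ℓ ℓ
    g′-elsewhere : ∀ {w} → w ≢ ρ → w ≢ ℓ → g′ ! w ≡ g ! w
    g′-elsewhere w≢ρ w≢ℓ = trans (update-off (g [ ρ ↦ a ]) ℓ ℓ w≢ℓ) (update-off g ρ a w≢ρ)

    first-ρ : Σ ℕ λ j → iter g j top ≡ ρ × j ≤ n × (∀ i → i < j → iter g i top ≢ ρ)
    first-ρ = least (λ j → iter g j top ≡ ρ) (λ j → iter g j top ≟ ρ) n refl

    J : ℕ
    J = proj₁ first-ρ

    top-to-ρ′ : iter g′ J top ≡ ρ
    top-to-ρ′ = trans (iter-agree g g′ top J (λ j j<J → g′-elsewhere (proj₂ (proj₂ (proj₂ first-ρ)) j j<J)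
        (λ e → path-avoids-cycle j mℓ (trans e (sym a-to-ℓ))))) (proj₁ (proj₂ first-ρ))

    first-ℓ : Σ ℕ λ m → iter g m a ≡ ℓ × m ≤ mℓ × (∀ i → i < m → iter g i a ≢ ℓ)
    first-ℓ = least (λ m → iter g m a ≡ ℓ) (λ m → iter g m a ≟ ℓ) mℓ a-to-ℓ

    M : ℕ
    M = proj₁ first-ℓ

    a-to-ℓ′ : iter g′ M a ≡ ℓ
    a-to-ℓ′ = trans (iter-agree g g′ a M (λ j j<M → g′-elsewhere (cycle-avoids-root j) (proj₂ (proj₂ (proj₂ first-ℓ)) j j<M)))
      (proj₁ (proj₂ first-ℓ))

    top-to-a′ : iter g′ (suc J) top ≡ a
    top-to-a′ = trans (cong (g′ !_) top-to-ρ′) g′ρ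

    root′ : root g′ ≡ ℓ
    root′ = reaches-within-n g′ (M + suc J) g′ℓ
      (trans (iter-+ g′ M (suc J) top) (trans (cong (iter g′ M) top-to-a′) a-to-ℓ′))

    fix′ : g′ ! root g′ ≡ root g′
    fix′ = subst (λ r → g′ ! r ≡ r) (sym root′) g′ℓ

    path′ : ∀ i → (Σ ℕ λ j → iter g′ i top ≡ iter g j top) ⊎ (Σ ℕ λ m → iter g′ i top ≡ iter g m a)
    path′ zero = inj₁ (0 , refl)
    path′ (suc i) with path′ i
    ... | inj₁ (j , e) with iter g j top ≟ ρ
    ...   | yes at-ρ = inj₂ (0 , trans (cong (g′ !_) (trans e at-ρ)) g′ρ)
    ...   | no not-ρ = inj₁ (suc j , trans (cong (g′ !_) e)
                         (g′-elsewhere not-ρ (λ e′ → path-avoids-cycle j mℓ (trans e′ (sym a-to-ℓ)))))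
    path′ (suc i) | inj₂ (m , e) with iter g m a ≟ ℓ
    ...   | yes at-ℓ = inj₂ (mℓ , trans (cong (g′ !_) (trans e at-ℓ)) (trans g′ℓ (sym a-to-ℓ)))
    ...   | no not-ℓ = inj₂ (suc m , trans (cong (g′ !_) e) (g′-elsewhere (cycle-avoids-root m) not-ℓ))

    a-below-path′ : ∀ w → OnPath g′ w → rank a ≤ rank w
    a-below-path′ w (i , e) with path′ (suc (toℕ i))
    ... | inj₁ (zero , e′) = <⇒≤ (subst (λ z → rank a < rank z) (trans (sym e′) e) a<top)
    ... | inj₁ (suc j , e′) = <⇒≤ (below a w a-candidate (onPath-iter g fix j (trans (sym e′) e)))
    ... | inj₂ (m , e′) = subst (λ z → rank a ≤ rank z) (trans (sym e′) e)
                            (cycleMin-all {g} (proj₁ a-candidate) (proj₂ (proj₂ a-candidate)) m)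

    admissible′ : Admissible g′
    admissible′ = admissible-update (g [ ρ ↦ a ]) ℓ ℓ (admissible-update g ρ a adm (<⇒≤ (below a ρ a-candidate (root-onPath g)))) ≤-refl

    -- every candidate of g′ is a candidate of g other than a, so lies below a
    below′ : CyclesBelowPath g′
    below′ c w (cycle , c≢root′ , cm) w-on = <-≤-trans c<a (a-below-path′ w w-on)
      where
      t : ℕ
      t = toℕ (proj₁ cycle)
      avoids-ℓ : ∀ m → iter g′ m c ≢ ℓ
      avoids-ℓ m e = c≢root′ (trans (periodic-fixed g′ t (proj₂ cycle) g′ℓ m e) (sym root′))
      avoids-ρ : ∀ m → iter g′ m c ≢ ρ
      avoids-ρ m e = avoids-ℓ (M + suc m)
        (trans (iter-+ g′ M (suc m) c) (trans (cong (iter g′ M) (trans (cong (g′ !_) e) g′ρ)) a-to-ℓ′))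
      c-candidate : Candidate g c
      c-candidate = candidate-transfer g g′ (λ m → g′-elsewhere (avoids-ρ m) (avoids-ℓ m)) (avoids-ρ 0) cycle cm
      c<a : rank c < rank a
      c<a = ≤∧≢⇒< (a-max c c-candidate) (λ e → avoids-ℓ M (trans (cong (iter g′ M) (rank-injective e)) a-to-ℓ′))

    good′ : Good g′
    good′ = admissible′ , fix′ , below′

    root′≢top : root g′ ≢ top
    root′≢top e = path-avoids-cycle 0 mℓ (trans (sym e) (trans root′ (sym a-to-ℓ)))

    -- backward recovers the choices: the lowest path vertex of g′ is a, and its
    -- predecessor on the path is ρ
    pathMin′ : pathMin g′ ≡ a
    pathMin′ = rank-injective (≤-antisym (proj₂ (pathMin-spec a-on) a a-on) (a-below-path′ _ (proj₁ (pathMin-spec a-on))))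
      where
      a-on : OnPath g′ a
      a-on = onPath-iter g′ fix′ J top-to-a′

    pathPred′ : pathPred g′ ≡ ρ
    pathPred′ = pathPred-unique g′ fix′ (proj₁ q-spec) ρ-on (trans (proj₁ (proj₂ q-spec)) (trans pathMin′ (sym g′ρ)))
        (λ e → proj₂ (proj₂ q-spec) (trans e (proj₁ (proj₂ q-spec))))
        (λ e → ρ≢a (trans e g′ρ))
      where
      ρ≢a : ρ ≢ a
      ρ≢a e = proj₁ (proj₂ a-candidate) (sym e)
      ρ-on : OnPath⁰ g′ ρ
      ρ-on = subst (OnPath⁰ g′) top-to-ρ′ (onPath⁰-iter g′ fix′ J)
      q-spec : PathPred g′ (pathPred g′)
      q-spec = pathPred-spec (ρ-on , trans g′ρ (sym pathMin′) , (λ e → ρ≢a (trans e pathMin′)))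

    backward-forward : backward (forward g) ≡ g
    backward-forward = begin
      backward g′                                 ≡⟨ cong₂ (λ r m → g′ [ r ↦ m ] [ pathPred g′ ↦ pathPred g′ ]) root′ pathMin′ ⟩
      g′ [ ℓ ↦ a ] [ pathPred g′ ↦ pathPred g′ ]  ≡⟨ cong (λ q → g′ [ ℓ ↦ a ] [ q ↦ q ]) pathPred′ ⟩
      g′ [ ℓ ↦ a ] [ ρ ↦ ρ ]                      ≡⟨ cong₂ (λ x y → g′ [ ℓ ↦ x ] [ ρ ↦ y ]) (sym gℓ≡a) (sym fix) ⟩
      g′ [ ℓ ↦ g ! ℓ ] [ ρ ↦ g ! ρ ]              ≡⟨ restore g g′ ρ ℓ g′-elsewhere ⟩
      g                                           ∎
      where open ≡-Reasoning

  -- In h′ = backward h the path from top stops at q, the new fixed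
  -- root, and the segment from a to r becomes a cycle with minimum a.
  module Backward (h : Fun) (good : Good h) (root≢top : root h ≢ top) where

    open import Data.Nat using (pred; ≢-nonZero)

    adm : Admissible h
    adm = proj₁ good
    fix : h ! root h ≡ root h
    fix = proj₁ (proj₂ good)
    below : CyclesBelowPath h
    below = proj₂ (proj₂ good)

    r : Fin n
    r = root h
    a : Fin n
    a = pathMin h
    a-on : OnPath h a
    a-on = proj₁ (pathMin-spec (root-onPath h))
    a-min : ∀ w → OnPath h w → rank a ≤ rank w
    a-min = proj₂ (pathMin-spec (root-onPath h))

    -- top is not periodic (otherwise it would be the root)
    top-not-revisited : ∀ i → iter h (suc i) top ≢ top
    top-not-revisited i e = root≢top (sym (periodic-fixed h i e fix n refl))

    a≢top : a ≢ top
    a≢top e = top-not-revisited (toℕ (proj₁ a-on)) (trans (proj₂ a-on) e)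

    first-a : Σ ℕ λ i → iter h i top ≡ a × i ≤ suc (toℕ (proj₁ a-on)) × (∀ j → j < i → iter h j top ≢ a)
    first-a = least (λ i → iter h i top ≡ a) (λ i → iter h i top ≟ a) (suc (toℕ (proj₁ a-on))) (proj₂ a-on)
    Ia : ℕ
    Ia = proj₁ first-a
    top-to-a : iter h Ia top ≡ a
    top-to-a = proj₁ (proj₂ first-a)
    before-a : ∀ j → j < Ia → iter h j top ≢ a
    before-a = proj₂ (proj₂ (proj₂ first-a))

    first-r : Σ ℕ λ i → iter h i top ≡ r × i ≤ n × (∀ j → j < i → iter h j top ≢ r)
    first-r = least (λ i → iter h i top ≡ r) (λ i → iter h i top ≟ r) n refl
    Ir : ℕ
    Ir = proj₁ first-r
    top-to-r : iter h Ir top ≡ r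
    top-to-r = proj₁ (proj₂ first-r)
    before-r : ∀ j → j < Ir → iter h j top ≢ r
    before-r = proj₂ (proj₂ (proj₂ first-r))

    Ia≤Ir : Ia ≤ Ir
    Ia≤Ir = ≮⇒≥ λ Ir<Ia → before-a Ir Ir<Ia
      (trans top-to-r (sym (trans (sym top-to-a) (iter-stays h fix top-to-r (<⇒≤ Ir<Ia)))))

    repeat-after-r : ∀ {j₁ j₂} → j₁ < j₂ → iter h j₁ top ≡ iter h j₂ top → Ir ≤ j₁
    repeat-after-r {j₁} lt e with m≤n⇒∃[o]m+o≡n lt
    ... | d , refl = ≮⇒≥ λ j₁<Ir → before-r j₁ j₁<Ir
      (collision-fixed h n j₁ d fix refl (trans e (cong (λ z → iter h (suc z) top) (+-comm j₁ d))))

    I′ : ℕ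
    I′ = pred Ia
    I′+1 : suc I′ ≡ Ia
    I′+1 = suc-pred Ia {{≢-nonZero λ Ia≡0 → a≢top (sym (subst (λ i → iter h i top ≡ a) Ia≡0 top-to-a))}}
    I′<Ia : I′ < Ia
    I′<Ia = subst (I′ <_) I′+1 ≤-refl

    u : Fin n
    u = iter h I′ top
    hu≡a : h ! u ≡ a
    hu≡a = trans (cong (λ z → iter h z top) I′+1) top-to-a
    u≢a : u ≢ a
    u≢a = before-a I′ I′<Ia
    u-on : OnPath⁰ h u
    u-on = onPath⁰-iter h fix I′
    a<u : rank a < rank u
    a<u = by-cases u-on
      where
      by-cases : OnPath⁰ h u → rank a < rank u
      by-cases (inj₁ u≡top) = subst (λ z → rank a < rank z) (sym u≡top) (below-top a≢top)
      by-cases (inj₂ on) = ≤∧≢⇒< (a-min u on) (λ e → u≢a (sym (rank-injective e)))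

    q : Fin n
    q = pathPred h
    q-spec : PathPred h q
    q-spec = pathPred-spec (u-on , hu≡a , u≢a)
    hq≡a : h ! q ≡ a
    hq≡a = proj₁ (proj₂ q-spec)
    q≢a : q ≢ a
    q≢a = proj₂ (proj₂ q-spec)
    q≡u : q ≡ u
    q≡u = pathPred-unique h fix (proj₁ q-spec) u-on (trans hq≡a (sym hu≡a))
            (λ e → q≢a (trans e hq≡a)) (λ e → u≢a (trans e hu≡a))
    q≢r : q ≢ r
    q≢r e = q≢a (trans e (sym (trans (sym hq≡a) (trans (cong (h !_) e) fix))))

    h′ : Fun
    h′ = backward h

    h′q : h′ ! q ≡ q
    h′q = update-at (h [ r ↦ a ]) q q
    h′r : h′ ! r ≡ a
    h′r = trans (update-off (h [ r ↦ a ]) q q (λ e → q≢r (sym e))) (update-at h r a)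
    h′-elsewhere : ∀ {w} → w ≢ r → w ≢ q → h′ ! w ≡ h ! w
    h′-elsewhere w≢r w≢q = trans (update-off (h [ r ↦ a ]) q q w≢q) (update-off h r a w≢r)

    path-agrees : ∀ j → j ≤ I′ → iter h′ j top ≡ iter h j top
    path-agrees j le = iter-agree h h′ top j (λ i i<j → h′-elsewhere (before-r i (i<Ir i<j))
      (λ e → <⇒≱ (i<Ir i<j) (repeat-after-r (<-≤-trans i<j le) (trans e q≡u))))
      where
      i<Ir : ∀ {i} → i < j → i < Ir
      i<Ir i<j = <-trans (<-≤-trans i<j le) (<-≤-trans I′<Ia Ia≤Ir)

    top-to-q′ : iter h′ I′ top ≡ q
    top-to-q′ = trans (path-agrees I′ ≤-refl) (sym q≡u)

    root′ : root h′ ≡ q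
    root′ = reaches-within-n h′ I′ h′q top-to-q′

    fix′ : h′ ! root h′ ≡ root h′
    fix′ = subst (λ z → h′ ! z ≡ z) (sym root′) h′q

    admissible′ : Admissible h′
    admissible′ = admissible-update (h [ r ↦ a ]) q q (admissible-update h r a adm (a-min r (root-onPath h))) ≤-refl

    L : ℕ
    L = proj₁ (m≤n⇒∃[o]m+o≡n Ia≤Ir)
    Ia+L : Ia + L ≡ Ir
    Ia+L = proj₂ (m≤n⇒∃[o]m+o≡n Ia≤Ir)

    segment : ∀ t → t ≤ L → iter h′ t a ≡ iter h (t + Ia) top
    segment zero _ = sym top-to-a
    segment (suc t) le = trans (cong (h′ !_) (segment t (<⇒≤ le))) (h′-elsewhere not-r not-q)
      where
      not-r : iter h (t + Ia) top ≢ r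
      not-r = before-r (t + Ia) (subst (t + Ia <_) (trans (+-comm L Ia) Ia+L) (+-monoˡ-< Ia le))
      not-q : iter h (t + Ia) top ≢ q
      not-q e = <⇒≱ (<-≤-trans I′<Ia Ia≤Ir)
        (repeat-after-r (<-≤-trans I′<Ia (m≤n+m Ia t)) (trans (sym q≡u) (sym e)))

    a-to-r′ : iter h′ L a ≡ r
    a-to-r′ = trans (segment L ≤-refl) (trans (cong (λ z → iter h z top) (trans (+-comm L Ia) Ia+L)) top-to-r)

    a-periodic′ : iter h′ (suc L) a ≡ a
    a-periodic′ = trans (cong (h′ !_) a-to-r′) h′r

    L<n : L < n
    L<n = begin-strict
      L          <⟨ m<m+n L (subst (0 <_) I′+1 (s≤s z≤n)) ⟩
      L + Ia     ≡⟨ trans (+-comm L Ia) Ia+L ⟩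
      Ir         ≤⟨ proj₁ (proj₂ (proj₂ first-r)) ⟩
      n          ∎
      where open ≤-Reasoning

    -- a is the minimum of its new cycle, whose points were old path points
    a-cycleMin′ : ∀ m → rank a ≤ rank (iter h′ m a)
    a-cycleMin′ m = on-segment (periodic-mod h′ L a-periodic′ m)
      where
      on-segment : Σ ℕ (λ t → t ≤ L × iter h′ m a ≡ iter h′ t a) → rank a ≤ rank (iter h′ m a)
      on-segment (t , t≤L , e) = subst (λ z → rank a ≤ rank z) (sym (trans e (segment t t≤L)))
        (a-min (iter h (t + Ia) top) (onPath-iter h fix (t + I′) reach))
        where
        reach : iter h (suc (t + I′)) top ≡ iter h (t + Ia) top
        reach = cong (λ z → iter h z top) (trans (sym (+-suc t I′)) (cong (t +_) I′+1))

    a-candidate′ : Candidate h′ a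
    a-candidate′ = onCycle-intro h′ L L<n a-periodic′ , (λ e → q≢a (trans (sym root′) (sym e))) , (λ k → a-cycleMin′ (toℕ k))

    -- the new path consists of old path points before a, and of q
    a-below-path′ : ∀ w → OnPath h′ w → rank a < rank w
    a-below-path′ w (i , e) = by-cases (suc (toℕ i) ≤? I′)
      where
      by-cases : Dec (suc (toℕ i) ≤ I′) → rank a < rank w
      by-cases (yes le) = ≤∧≢⇒< (a-min w (onPath-iter h fix (toℕ i) old))
          (λ a≡w → before-a (suc (toℕ i)) (<-≤-trans (s≤s le) (≤-reflexive I′+1)) (trans old (sym (rank-injective a≡w))))
        where
        old : iter h (suc (toℕ i)) top ≡ w
        old = trans (sym (path-agrees (suc (toℕ i)) le)) e
      by-cases (no gt) = subst (λ z → rank a < rank z)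
        (trans (sym q≡u) (trans (sym (iter-stays h′ h′q top-to-q′ (<⇒≤ (≰⇒> gt)))) e)) a<u

    -- a candidate of h′ either meets r, and then lies below h′ r = a, or is
    -- an old candidate, and then lies below the old path vertex a
    candidates-below′ : ∀ c → Candidate h′ c → rank c ≤ rank a
    candidates-below′ c (cycle , c≢root′ , cm) = by-cases (any? (λ (m : Fin (suc n)) → iter h′ (toℕ m) c ≟ r))
      where
      by-cases : Dec (Σ (Fin (suc n)) λ m → iter h′ (toℕ m) c ≡ r) → rank c ≤ rank a
      by-cases (yes (m , hits-r)) = subst (λ z → rank c ≤ rank z) (trans (cong (h′ !_) hits-r) h′r)
                                      (cycleMin-all {h′} cycle cm (suc (toℕ m)))
      by-cases (no misses-r) = <⇒≤ (below c a (candidate-transfer h h′ (λ m → h′-elsewhere (avoids-r m) (avoids-q m)) (avoids-r 0) cycle cm) a-on)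
        where
        avoids-r : ∀ m → iter h′ m c ≢ r
        avoids-r m e = misses-r (proj₁ (cycle-orbit-bounded {h′} cycle m) , trans (sym (proj₂ (cycle-orbit-bounded {h′} cycle m))) e)
        avoids-q : ∀ m → iter h′ m c ≢ q
        avoids-q m e = c≢root′ (trans (periodic-fixed h′ (toℕ (proj₁ cycle)) (proj₂ cycle) h′q m e) (sym root′))

    good′ : Good h′
    good′ = admissible′ , fix′ , λ c w cc w-on → ≤-<-trans (candidates-below′ c cc) (a-below-path′ w w-on)

    has′ : HasCandidate h′
    has′ = a , a-candidate′

    -- forward recovers the choices: the top candidate of h′ is a, and its
    -- predecessor on the cycle is r
    topCandidate′ : topCandidate h′ ≡ a
    topCandidate′ = rank-injective (≤-antisym (candidates-below′ _ (proj₁ (topCandidate-spec a-candidate′)))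
                                              (proj₂ (topCandidate-spec a-candidate′) a a-candidate′))

    cyclePred′ : cyclePred h′ a ≡ r
    cyclePred′ = trans (sym from-a) (trans (cycle-injective h′ L a-periodic′ m L same-image) a-to-r′)
      where
      spec : h′ ! cyclePred h′ a ≡ a × Σ ℕ (λ m → iter h′ m a ≡ cyclePred h′ a)
      spec = cyclePred-spec h′ (proj₁ a-candidate′)
      m : ℕ
      m = proj₁ (proj₂ spec)
      from-a : iter h′ m a ≡ cyclePred h′ a
      from-a = proj₂ (proj₂ spec)
      same-image : h′ ! iter h′ m a ≡ h′ ! iter h′ L a
      same-image = trans (cong (h′ !_) from-a) (trans (proj₁ spec) (sym a-periodic′))

    forward-backward : forward (backward h) ≡ h
    forward-backward = begin
      forward h′
        ≡⟨ cong₂ (λ x y → h′ [ x ↦ y ] [ cyclePred h′ y ↦ cyclePred h′ y ]) root′ topCandidate′ ⟩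
      h′ [ q ↦ a ] [ cyclePred h′ a ↦ cyclePred h′ a ]  ≡⟨ cong (λ z → h′ [ q ↦ a ] [ z ↦ z ]) cyclePred′ ⟩
      h′ [ q ↦ a ] [ r ↦ r ]                            ≡⟨ cong₂ (λ x y → h′ [ q ↦ x ] [ r ↦ y ]) (sym hq≡a) (sym fix) ⟩
      h′ [ q ↦ h ! q ] [ r ↦ h ! r ]                    ≡⟨ restore h h′ r q h′-elsewhere ⟩
      h                                                 ∎
      where open ≡-Reasoning

-- Directed trees on Fin n are the same as maps g whose orbits all end in a
-- fixed point r: the tree has the arrows v → g v for v ≠ r.
module TreeMaps (n : ℕ) where

  open Iteration n

  open import Data.Nat using (zero; suc)
  open import Data.Nat.Properties using (1+n≢n)
  open import Data.Bool using (Bool; true; false; _∧_; not)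
  import Data.Bool.Properties as Bool
  open import Data.Fin using (Fin)
  open import Data.Fin.Properties using (_≟_; any?)
  open import Data.Vec using (Vec; lookup; tabulate)
  open import Data.Vec.Properties using (lookup∘tabulate)
  open import Data.Vec.Relation.Binary.Pointwise.Extensional using (ext; Pointwise-≡⇒≡)
  open import Data.Product using (_×_; _,_; proj₁; proj₂)
  open import Data.Sum using (_⊎_; inj₁; inj₂)
  open import Data.Empty using (⊥-elim)
  open import Relation.Nullary using (¬_; Dec; yes; no; does)
  open import Axiom.UniquenessOfIdentityProofs using (module Decidable⇒UIP)
  open import Relation.Binary.PropositionalEquality using (_≡_; _≢_; refl; sym; trans; cong; cong₂; subst)

  graphOf : Fun → Digraph n
  graphOf g = tabulate (λ u → tabulate (λ w → does (g ! u ≟ w) ∧ not (does (u ≟ w))))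

  graphOf-entry : ∀ g u w → lookup (lookup (graphOf g) u) w ≡ (does (g ! u ≟ w) ∧ not (does (u ≟ w)))
  graphOf-entry g u w = trans (cong (λ row → lookup row w) (lookup∘tabulate _ u)) (lookup∘tabulate _ w)

  graphOf-arrow⁻ : ∀ g {u w} → Arrow (graphOf g) u w → g ! u ≡ w × u ≢ w
  graphOf-arrow⁻ g {u} {w} a with g ! u ≟ w | u ≟ w | trans (sym (graphOf-entry g u w)) a
  ... | yes e | no ne | _ = e , ne
  ... | yes _ | yes _ | ()
  ... | no _ | _ | ()

  graphOf-arrow⁺ : ∀ g {u w} → g ! u ≡ w → u ≢ w → Arrow (graphOf g) u w
  graphOf-arrow⁺ g {u} {w} e ne with g ! u ≟ w | u ≟ w | graphOf-entry g u w
  ... | yes _ | no _ | entry = entry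
  ... | no ne′ | _ | _ = ⊥-elim (ne′ e)
  ... | yes _ | yes e′ | _ = ⊥-elim (ne e′)

  -- a map is determined by its digraph (fixed points are the vertices without arrows)
  graphOf-injective : ∀ {g g′} → graphOf g ≡ graphOf g′ → g ≡ g′
  graphOf-injective {g} {g′} eq = fun-ext same
    where
    move : ∀ g g′ → graphOf g ≡ graphOf g′ → ∀ {u} → g ! u ≢ u → g′ ! u ≡ g ! u
    move g g′ eq {u} ne =
      proj₁ (graphOf-arrow⁻ g′ (subst (λ T → Arrow T u (g ! u)) eq (graphOf-arrow⁺ g refl (λ e → ne (sym e)))))
    same : ∀ u → g ! u ≡ g′ ! u
    same u with g ! u ≟ u | g′ ! u ≟ u
    ... | yes e | yes e′ = trans e (sym e′)
    ... | yes _ | no ne′ = move g′ g (sym eq) ne′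
    ... | no ne | _ = sym (move g g′ eq ne)

  graphOf-tree : ∀ g {r} → g ! r ≡ r → (∀ v → iter g n v ≡ r) → IsDirectedTreeWithRoot (graphOf g) r
  graphOf-tree g {r} fix reach v = walk-to n v (reach v) , λ q → walk-unique q _
    where
    walk-to : ∀ k v → iter g k v ≡ r → Walk (graphOf g) v r
    walk-to zero v e = subst (Walk (graphOf g) v) e nil
    walk-to (suc k) v e with v ≟ r
    ... | yes refl = nil
    ... | no v≢r = cons (graphOf-arrow⁺ g refl v≢gv) (walk-to k (g ! v) (trans (sym (iter-suc′ g k v)) e))
      where
      v≢gv : v ≢ g ! v
      v≢gv v≡gv = v≢r (trans (sym (iter-fixed g (sym v≡gv) (suc k))) e)
    root-has-no-arrow : ∀ {w} → ¬ Arrow (graphOf g) r w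
    root-has-no-arrow a = proj₂ (graphOf-arrow⁻ g a) (trans (sym fix) (proj₁ (graphOf-arrow⁻ g a)))
    -- every vertex other than r has exactly one arrow, so walks to r are unique
    walk-unique : ∀ {v} (p q : Walk (graphOf g) v r) → p ≡ q
    walk-unique nil nil = refl
    walk-unique nil (cons a q) = ⊥-elim (root-has-no-arrow a)
    walk-unique (cons a p) nil = ⊥-elim (root-has-no-arrow a)
    walk-unique (cons a p) (cons b q) with trans (sym (proj₁ (graphOf-arrow⁻ g a))) (proj₁ (graphOf-arrow⁻ g b))
    ... | refl = cong₂ cons (Decidable⇒UIP.≡-irrelevant Bool._≟_ a b) (walk-unique p q)

  -- conversely every directed tree with root r is graphOf of a map whose
  -- orbits all end in r: send each vertex along its unique arrow
  module FromTree (T : Digraph n) (r : Fin n) (tree : IsDirectedTreeWithRoot T r) where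

    path : ∀ v → Walk T v r
    path v = proj₁ (tree v)

    path-unique : ∀ {v} (q : Walk T v r) → q ≡ path v
    path-unique {v} q = proj₂ (tree v) q

    no-loop : ∀ u → ¬ Arrow T u u
    no-loop u a = 1+n≢n (cong walk-length (path-unique (cons a (path u))))

    arrow-unique : ∀ {u w₁ w₂} → Arrow T u w₁ → Arrow T u w₂ → w₁ ≡ w₂
    arrow-unique a b = next (trans (path-unique (cons a (path _))) (sym (path-unique (cons b (path _)))))
      where
      next : ∀ {u w₁ w₂} {a : Arrow T u w₁} {b : Arrow T u w₂} {p : Walk T w₁ r} {q : Walk T w₂ r} →
        cons a p ≡ cons b q → w₁ ≡ w₂
      next refl = refl

    root-has-no-arrow : ∀ w → ¬ Arrow T r w
    root-has-no-arrow w a with trans (path-unique nil) (sym (path-unique (cons a (path w))))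
    ... | ()

    Arrow? : ∀ u w → Dec (Arrow T u w)
    Arrow? u w = lookup (lookup T u) w Bool.≟ true

    successor : Fin n → Fin n
    successor u with any? (Arrow? u)
    ... | yes (w , _) = w
    ... | no _ = u

    treeMap : Fun
    treeMap = tabulate successor

    treeMap-arrow : ∀ {u w} → Arrow T u w → treeMap ! u ≡ w
    treeMap-arrow {u} {w} a with any? (Arrow? u) | lookup∘tabulate successor u
    ... | yes (w′ , a′) | e = trans e (arrow-unique a′ a)
    ... | no none | _ = ⊥-elim (none (w , a))

    treeMap-step : ∀ u → treeMap ! u ≡ u ⊎ Arrow T u (treeMap ! u)
    treeMap-step u with any? (Arrow? u) | lookup∘tabulate successor u
    ... | yes (w , a) | e = inj₂ (subst (Arrow T u) (sym e) a)
    ... | no _ | e = inj₁ e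

    T≡graphOf : T ≡ graphOf treeMap
    T≡graphOf = Pointwise-≡⇒≡ (ext λ u → Pointwise-≡⇒≡ (ext λ w → same-entry u w))
      where
      from-graph : ∀ {u w} → Arrow (graphOf treeMap) u w → Arrow T u w
      from-graph {u} a with graphOf-arrow⁻ treeMap a | treeMap-step u
      ... | refl , ne | inj₁ fixed = ⊥-elim (ne (sym fixed))
      ... | refl , _ | inj₂ a′ = a′
      same-entry : ∀ u w → lookup (lookup T u) w ≡ lookup (lookup (graphOf treeMap) u) w
      same-entry u w with lookup (lookup T u) w in e₁ | lookup (lookup (graphOf treeMap) u) w in e₂
      ... | true | true = refl
      ... | false | false = refl
      ... | true | false with () ← trans (sym (graphOf-arrow⁺ treeMap (treeMap-arrow e₁) (λ { refl → no-loop u e₁ }))) e₂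
      ... | false | true with () ← trans (sym (from-graph e₂)) e₁

    root-fixed : treeMap ! r ≡ r
    root-fixed with treeMap-step r
    ... | inj₁ fixed = fixed
    ... | inj₂ a = ⊥-elim (root-has-no-arrow _ a)

    all-reach : ∀ v → iter treeMap n v ≡ r
    all-reach v = reaches-within-n treeMap (walk-length (path v)) root-fixed (along (path v))
      where
      along : ∀ {v} (p : Walk T v r) → iter treeMap (walk-length p) v ≡ r
      along nil = refl
      along {v} (cons a p) = trans (iter-suc′ treeMap (walk-length p) v) (trans (cong (iter treeMap (walk-length p)) (treeMap-arrow a)) (along p))

module Counting {n : ℕ} {D : Digraph n} (R : Ranked D) where

  open Ranked R
  open Core R
  open TreeMaps n
  open ListCounting

  open import Data.Nat using (suc; _+_; _*_; _≤_)
  open import Data.Nat.Properties using (*-comm; +-comm; +-cancelʳ-≡; ≤-refl)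
  open import Data.Bool using (true; false; if_then_else_)
  open import Data.Fin using (Fin)
  open import Data.Fin.Properties using (_≟_)
  open import Data.Vec using (lookup)
  open import Data.List using (List; []; _∷_; map; length; filter; allFin; cartesianProduct; tabulate)
  open import Data.List.Properties using (length-map; length-tabulate; map-tabulate; tabulate-cong)
  open import Data.Nat.ListAction using (sum; product)
  open import Data.List.Membership.Propositional using (_∈_)
  open import Data.List.Membership.Propositional.Properties using (∈-map⁺; ∈-map⁻; ∈-filter⁺; ∈-filter⁻; ∈-allFin; ∈-cartesianProduct⁺; ∈-cartesianProduct⁻)
  open import Data.List.Relation.Unary.Unique.Propositional using (Unique)
  open import Data.List.Relation.Unary.Unique.Propositional.Properties using (filter⁺; allFin⁺; cartesianProduct⁺; map⁺)
  open import Data.Product using (Σ; _×_; _,_; proj₁; proj₂)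
  open import Data.Sum using (inj₁; inj₂)
  open import Function.Bundles using (_⇔_; mk⇔)
  open import Relation.Nullary using (¬_; Dec; yes; no; ¬?)
  open import Relation.Binary.PropositionalEquality using (_≡_; _≢_; refl; sym; trans; cong; cong₂; subst; module ≡-Reasoning)

  targets : Fin n → List (Fin n)
  targets v = filter (λ w → ¬? (Arrow? v w)) (allFin n)

  length-targets : ∀ v → length (targets v) ≡ complOutDeg D v
  length-targets v = as-sum (allFin n)
    where
    as-sum : ∀ xs → length (filter (λ w → ¬? (Arrow? v w)) xs) ≡ sum (map (λ w → if lookup (lookup D v) w then 0 else 1) xs)
    as-sum [] = refl
    as-sum (w ∷ xs) with lookup (lookup D v) w
    ... | true = as-sum xs
    ... | false = cong suc (as-sum xs)

  admissibleMaps : List Fun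
  admissibleMaps = choices n targets

  admissibleMaps-unique : Unique admissibleMaps
  admissibleMaps-unique = choices-unique n targets (λ v → filter⁺ (λ w → ¬? (Arrow? v w)) (allFin⁺ n))

  admissibleMaps⁺ : ∀ {g} → Admissible g → g ∈ admissibleMaps
  admissibleMaps⁺ {g} adm = ∈-choices⁺ n targets g (λ v → ∈-filter⁺ (λ w → ¬? (Arrow? v w)) (∈-allFin (g ! v)) (adm v))

  admissibleMaps⁻ : ∀ {g} → g ∈ admissibleMaps → Admissible g
  admissibleMaps⁻ {g} p v = proj₂ (∈-filter⁻ (λ w → ¬? (Arrow? v w)) {xs = allFin n} (∈-choices⁻ n targets g p v))

  length-admissibleMaps : length admissibleMaps ≡ prodComplOutDeg D
  length-admissibleMaps = begin
    length (choices n targets)                     ≡⟨ length-choices n targets ⟩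
    product (tabulate (λ v → length (targets v)))  ≡⟨ cong product (tabulate-cong length-targets) ⟩
    product (tabulate (complOutDeg D))             ≡⟨ cong product (sym (map-tabulate (λ v → v) (complOutDeg D))) ⟩
    prodComplOutDeg D                              ∎
    where open ≡-Reasoning

  goodMaps : List Fun
  goodMaps = filter Good? admissibleMaps

  goodMaps-unique : Unique goodMaps
  goodMaps-unique = filter⁺ Good? admissibleMaps-unique

  goodMaps⁺ : ∀ {g} → Good g → g ∈ goodMaps
  goodMaps⁺ good = ∈-filter⁺ Good? (admissibleMaps⁺ (proj₁ good)) good

  goodMaps⁻ : ∀ {g} → g ∈ goodMaps → Good g
  goodMaps⁻ p = proj₂ (∈-filter⁻ Good? {xs = admissibleMaps} p)

  RootTop? : ∀ g → Dec (root g ≡ top)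
  RootTop? g = root g ≟ top

  treeMaps withCandidate rootTop rootNotTop : List Fun
  treeMaps = filter (λ g → ¬? (HasCandidate? g)) goodMaps
  withCandidate = filter HasCandidate? goodMaps
  rootTop = filter RootTop? goodMaps
  rootNotTop = filter (λ g → ¬? (RootTop? g)) goodMaps

  withCandidate≈rootNotTop : length withCandidate ≡ length rootNotTop
  withCandidate≈rootNotTop = bijection-length withCandidate rootNotTop
    (filter⁺ HasCandidate? goodMaps-unique) (filter⁺ (λ g → ¬? (RootTop? g)) goodMaps-unique)
    forward backward forward∈ backward∈ backward-forward forward-backward
    where
    split-withCandidate : ∀ {g} → g ∈ withCandidate → Good g × HasCandidate g
    split-withCandidate p with ∈-filter⁻ HasCandidate? {xs = goodMaps} p
    ... | g∈ , has = goodMaps⁻ g∈ , has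
    split-rootNotTop : ∀ {h} → h ∈ rootNotTop → Good h × root h ≢ top
    split-rootNotTop p with ∈-filter⁻ (λ g → ¬? (RootTop? g)) {xs = goodMaps} p
    ... | h∈ , not-top = goodMaps⁻ h∈ , not-top
    forward∈ : ∀ {g} → g ∈ withCandidate → forward g ∈ rootNotTop
    forward∈ {g} p with split-withCandidate p
    ... | good , has = ∈-filter⁺ (λ g → ¬? (RootTop? g)) (goodMaps⁺ F.good′) F.root′≢top
      where module F = Forward g good has
    backward∈ : ∀ {h} → h ∈ rootNotTop → backward h ∈ withCandidate
    backward∈ {h} p with split-rootNotTop p
    ... | good , not-top = ∈-filter⁺ HasCandidate? (goodMaps⁺ B.good′) B.has′
      where module B = Backward h good not-top
    backward-forward : ∀ {g} → g ∈ withCandidate → backward (forward g) ≡ g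
    backward-forward {g} p with split-withCandidate p
    ... | good , has = Forward.backward-forward g good has
    forward-backward : ∀ {h} → h ∈ rootNotTop → forward (backward h) ≡ h
    forward-backward {h} p with split-rootNotTop p
    ... | good , not-top = Backward.forward-backward h good not-top

  treeMaps≈rootTop : length treeMaps ≡ length rootTop
  treeMaps≈rootTop = +-cancelʳ-≡ (length withCandidate) (length treeMaps) (length rootTop) (begin
    length treeMaps + length withCandidate  ≡⟨ +-comm (length treeMaps) (length withCandidate) ⟩
    length withCandidate + length treeMaps  ≡⟨ length-filter-split HasCandidate? goodMaps ⟩
    length goodMaps                         ≡⟨ sym (length-filter-split RootTop? goodMaps) ⟩
    length rootTop + length rootNotTop      ≡⟨ cong (length rootTop +_) (sym withCandidate≈rootNotTop) ⟩
    length rootTop + length withCandidate   ∎)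
    where open ≡-Reasoning

  -- an admissible map is a map fixing top together with the target of top
  admissibleMaps≈rootTop×vertices : length admissibleMaps ≡ length rootTop * n
  admissibleMaps≈rootTop×vertices = begin
    length admissibleMaps                           ≡⟨ bijection-length admissibleMaps pairs admissibleMaps-unique pairs-unique
                                                         split join split∈ join∈ join-split split-join ⟩
    length pairs                                    ≡⟨ length-cartesianProductWith _,_ rootTop (allFin n) ⟩
    length rootTop * length (allFin n)              ≡⟨ cong (length rootTop *_) (length-tabulate (λ v → v)) ⟩
    length rootTop * n                              ∎
    where
    open ≡-Reasoning
    pairs : List (Fun × Fin n)
    pairs = cartesianProduct rootTop (allFin n)
    pairs-unique : Unique pairs
    pairs-unique = cartesianProduct⁺ (filter⁺ RootTop? goodMaps-unique) (allFin⁺ n)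
    rootTop⁻ : ∀ {g} → g ∈ rootTop → Good g × root g ≡ top
    rootTop⁻ p with ∈-filter⁻ RootTop? {xs = goodMaps} p
    ... | g∈ , root≡top = goodMaps⁻ g∈ , root≡top
    split : Fun → Fun × Fin n
    split f = f [ top ↦ top ] , f ! top
    join : Fun × Fin n → Fun
    join (g , m) = g [ top ↦ m ]
    split∈ : ∀ {f} → f ∈ admissibleMaps → split f ∈ pairs
    split∈ {f} p = ∈-cartesianProduct⁺ (∈-filter⁺ RootTop? (goodMaps⁺ (proj₁ fixing)) (proj₂ fixing)) (∈-allFin _)
      where
      fixing : Good (f [ top ↦ top ]) × root (f [ top ↦ top ]) ≡ top
      fixing = fixing-top-good (f [ top ↦ top ]) (admissible-update f top top (admissibleMaps⁻ p) ≤-refl) (update-at f top top)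
    join∈ : ∀ {x} → x ∈ pairs → join x ∈ admissibleMaps
    join∈ {g , m} p with ∈-cartesianProduct⁻ rootTop (allFin n) p
    ... | g∈ , _ = admissibleMaps⁺ (admissible-update g top m (proj₁ (proj₁ (rootTop⁻ g∈))) (top-max m))
    join-split : ∀ {f} → f ∈ admissibleMaps → join (split f) ≡ f
    join-split {f} _ = fun-ext same
      where
      same : ∀ v → f [ top ↦ top ] [ top ↦ f ! top ] ! v ≡ f ! v
      same v with v ≟ top
      ... | yes refl = update-at (f [ top ↦ top ]) top (f ! top)
      ... | no v≢top = trans (update-off (f [ top ↦ top ]) top (f ! top) v≢top) (update-off f top top v≢top)
    split-join : ∀ {x} → x ∈ pairs → split (join x) ≡ x
    split-join {g , m} p with ∈-cartesianProduct⁻ rootTop (allFin n) p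
    ... | g∈ , _ = cong₂ _,_ (fun-ext same) (update-at g top m)
      where
      g-fixes-top : g ! top ≡ top
      g-fixes-top with rootTop⁻ g∈
      ... | (_ , fix , _) , root≡top = subst (λ z → g ! z ≡ z) root≡top fix
      same : ∀ v → g [ top ↦ m ] [ top ↦ top ] ! v ≡ g ! v
      same v with v ≟ top
      ... | yes refl = trans (update-at (g [ top ↦ m ]) top top) (sym g-fixes-top)
      ... | no v≢top = trans (update-off (g [ top ↦ m ]) top top v≢top) (update-off g top m v≢top)

  trees : List (Digraph n)
  trees = map graphOf treeMaps

  trees-unique : Unique trees
  trees-unique = map⁺ graphOf-injective (filter⁺ (λ g → ¬? (HasCandidate? g)) goodMaps-unique)

  trees-spec : ∀ T → (T ∈ trees) ⇔ IsDirectedSpanningTreeOnComplement D T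
  trees-spec T = mk⇔ to from
    where
    to : T ∈ trees → IsDirectedSpanningTreeOnComplement D T
    to p with ∈-map⁻ graphOf p
    ... | g , g∈ , refl with ∈-filter⁻ (λ g → ¬? (HasCandidate? g)) {xs = goodMaps} g∈
    ... | g-good , none = in-complement , root g , graphOf-tree g fix (no-candidate-tree g good none)
      where
      good : Good g
      good = goodMaps⁻ g-good
      fix : g ! root g ≡ root g
      fix = proj₁ (proj₂ good)
      in-complement : SubOfComplement (graphOf g) D
      in-complement u w a d = proj₁ good u (subst (Arrow D u) (sym (proj₁ (graphOf-arrow⁻ g a))) d)
    from : IsDirectedSpanningTreeOnComplement D T → T ∈ trees
    from (in-complement , r , tree) =
      subst (_∈ trees) (sym T≡graphOf) (∈-map⁺ graphOf (∈-filter⁺ (λ g → ¬? (HasCandidate? g)) (goodMaps⁺ (proj₁ as-tree)) (proj₂ as-tree)))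
      where
      open FromTree T r tree
      adm : Admissible treeMap
      adm u with treeMap-step u
      ... | inj₁ fixed = subst (λ z → ¬ Arrow D u z) (sym fixed) (no-arrow-down ≤-refl)
      ... | inj₂ a = in-complement u (treeMap ! u) a
      root≡r : root treeMap ≡ r
      root≡r = all-reach top
      as-tree : Good treeMap × ¬ HasCandidate treeMap
      as-tree = tree-good treeMap adm (subst (λ z → treeMap ! z ≡ z) (sym root≡r) root-fixed)
                  (λ v → trans (all-reach v) (sym root≡r))

  count : n * length trees ≡ prodComplOutDeg D
  count = begin
    n * length trees           ≡⟨ cong (n *_) (length-map graphOf treeMaps) ⟩
    n * length treeMaps        ≡⟨ cong (n *_) treeMaps≈rootTop ⟩
    n * length rootTop         ≡⟨ *-comm n (length rootTop) ⟩
    length rootTop * n         ≡⟨ sym admissibleMaps≈rootTop×vertices ⟩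
    length admissibleMaps      ≡⟨ length-admissibleMaps ⟩
    prodComplOutDeg D          ∎
    where open ≡-Reasoning

corollary2p3 : (n : ℕ) → 1 ≤ n → (D : Digraph n) → Acyclic D →
    Σ (List (Digraph n)) (λ trees →
      Unique trees ×
      (∀ T → (T ∈ trees) ⇔ IsDirectedSpanningTreeOnComplement D T) ×
      n * length trees ≡ prodComplOutDeg D)
corollary2p3 n n≥1 D acyclic = trees , trees-unique , trees-spec , count
  where open Counting (Ranking.ranked D acyclic n≥1)
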